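{- Let $\nu$ be a positive integer and, for $k=1,\dots,\nu$, let $N_k=n_k+n_{k+1}+\dots+n_\nu$. Then for every non-negative integer $M$, \[ \sum_{n_1,\dots,n_\nu\geq 0} \frac{q^{3(N_1^2 + N_2^2+\dots + N_\nu^2)}(-q;q^2)_{3n_\nu}}{(q^6;q^6)_{M-N_1}(q^6;q^6)_{n_1}(q^6;q^6)_{n_2}\cdots (q^6;q^6)_{n_{\nu-1}}(q^6;q^6)_{2n_\nu}} = \frac{(-q^3;q^6)_M}{(q^6;q^6)_{2M}} \sum_{j=-M}^M q^{3(\nu+1)j^2 + 2j} {2M \brack M+j}_{q^6}. \]
   Context: For $n\ge 0$, $(a;q)_n=\prod_{k=0}^{n-1}(1-aq^k)$, and by convention $\frac{1}{(q;q)_n}=0$ for negative integers $n$ (so terms with $N_1>M$ vanish). For integers $A,B$, ${A\brack B}_x=\frac{(x;x)_A}{(x;x)_B(x;x)_{A-B}}$ if $B\ge 0$ and $A-B\ge 0$, and $0$ otherwise. -}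

module Defs where

open import Data.Nat as ℕ using (ℕ; zero; suc; _∸_)
open import Data.Nat.Divisibility using (_∣?_)
open import Data.Integer as ℤ using (ℤ; +_; -[1+_]; ∣_∣)
open import Data.List using (List; []; _∷_; foldr; map; upTo; concatMap)
open import Data.Vec using (Vec; []; _∷_)
open import Relation.Nullary using (yes; no)
open import Relation.Binary.PropositionalEquality using (_≡_)

-- Formal power series in q with integer coefficients:
-- a series is its coefficient sequence.

Series : Set
Series = ℕ → ℤ

0s : Series
0s _ = + 0

qpow : ℕ → Series
qpow k n with k ℕ.≟ n
... | yes _ = + 1
... | no  _ = + 0

1s : Series
1s = qpow 0

_+s_ : Series → Series → Series
(f +s g) n = f n ℤ.+ g n

_·s_ : ℤ → Series → Series
(c ·s f) n = c ℤ.* f n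

_*s_ : Series → Series → Series
(f *s g) n = foldr ℤ._+_ (+ 0) (map (λ i → f i ℤ.* g (n ∸ i)) (upTo (suc n)))

infixl 6 _+s_
infixl 7 _*s_ _·s_

sumS : List Series → Series
sumS = foldr _+s_ 0s

prodS : List Series → Series
prodS = foldr _*s_ 1s

_≈s_ : Series → Series → Set
f ≈s g = ∀ n → f n ≡ g n

-- (c q^e ; q^s)_n = ∏_{k=0}^{n-1} (1 - c q^{e + s k})
poch : ℤ → ℕ → ℕ → ℕ → Series
poch c e s n = prodS (map (λ k → 1s +s (ℤ.- c) ·s qpow (e ℕ.+ s ℕ.* k)) (upTo n))

qfac : ℕ → ℕ → Series
qfac d n = poch (+ 1) d d n

-- 1/(1 - q^m) = Σ_{i≥0} q^{m i}   (for m ≥ 1)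
geom : ℕ → Series
geom m n with m ∣? n
... | yes _ = + 1
... | no  _ = + 0

-- 1/(q^d ; q^d)_n = ∏_{k=1}^{n} 1/(1 - q^{d k})   (power series inverse, d ≥ 1)
recipQfac : ℕ → ℕ → Series
recipQfac d n = prodS (map (λ k → geom (d ℕ.* suc k)) (upTo n))

-- convention: 1/(q^d;q^d)_n = 0 for negative integers n
recipQfacℤ : ℕ → ℤ → Series
recipQfacℤ d (+ n)     = recipQfac d n
recipQfacℤ d -[1+ n ]  = 0s

gaussBinom : ℕ → ℤ → ℤ → Series
gaussBinom d (+ a) (+ b) with b ℕ.≤? a
... | yes _ = qfac d a *s recipQfac d b *s recipQfac d (a ∸ b)
... | no  _ = 0s
gaussBinom d (+ a) -[1+ b ] = 0s
gaussBinom d -[1+ a ] b = 0s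

boxVecs : (k M : ℕ) → List (Vec ℕ k)
boxVecs zero M = [] ∷ []
boxVecs (suc k) M = concatMap (λ x → map (x ∷_) (boxVecs k M)) (upTo (suc M))

vsum : ∀ {k} → Vec ℕ k → ℕ
vsum [] = 0
vsum (x ∷ xs) = x ℕ.+ vsum xs

-- for v = (n_1,...,n_ν):  N_1^2 + ... + N_ν^2  with N_k = n_k + ... + n_ν
sqSuffix : ∀ {k} → Vec ℕ k → ℕ
sqSuffix [] = 0
sqSuffix (x ∷ xs) = (x ℕ.+ vsum xs) ℕ.* (x ℕ.+ vsum xs) ℕ.+ sqSuffix xs

lastV : ∀ {k} → Vec ℕ (suc k) → ℕ
lastV (x ∷ []) = x
lastV (x ∷ y ∷ ys) = lastV (y ∷ ys)

-- 1/((q^6;q^6)_{n_1} ... (q^6;q^6)_{n_{ν-1}} (q^6;q^6)_{2 n_ν})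
denoms : ∀ {k} → Vec ℕ (suc k) → Series
denoms (x ∷ []) = recipQfac 6 (2 ℕ.* x)
denoms (x ∷ y ∷ ys) = recipQfac 6 x *s denoms (y ∷ ys)

-- summand of the left-hand side, ν = suc μ, v = (n_1,...,n_ν)
lhsTerm : (μ M : ℕ) → Vec ℕ (suc μ) → Series
lhsTerm μ M v =
  qpow (3 ℕ.* sqSuffix v)
  *s poch (ℤ.- (+ 1)) 1 2 (3 ℕ.* lastV v)
  *s recipQfacℤ 6 (+ M ℤ.- + vsum v)
  *s denoms v

-- Left-hand side.  The sum over all n_1,...,n_ν ≥ 0 is taken over the box
-- 0 ≤ n_i ≤ M: every other term has N_1 > M and hence vanishes by the
-- convention 1/(q^6;q^6)_{M-N_1} = 0.
LHS : (ν M : ℕ) → Series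
LHS zero M = 0s
LHS (suc μ) M = sumS (map (lhsTerm μ M) (boxVecs (suc μ) M))

symRange : ℕ → List ℤ
symRange M = map (λ i → + i ℤ.- + M) (upTo (suc (2 ℕ.* M)))

RHS : (ν M : ℕ) → Series
RHS ν M =
  poch (ℤ.- (+ 1)) 3 6 M *s recipQfac 6 (2 ℕ.* M)
  *s sumS (map (λ j →
        qpow ∣ + (3 ℕ.* (ν ℕ.+ 1)) ℤ.* j ℤ.* j ℤ.+ + 2 ℤ.* j ∣
        *s gaussBinom 6 (+ (2 ℕ.* M)) (+ M ℤ.+ j))
      (symRange M))

module Submission where

-- The proof is a Bailey chain.  Put
--   closedForm ν M = (-q^3;q^6)_M Σ_{|j|≤M} q^(3(ν+1)j²+2j) / ((q^6)_(M-j) (q^6)_(M+j)),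
-- which is the right-hand side because [2M, M+j]/(q^6)_(2M) = 1/((q^6)_(M-j)(q^6)_(M+j)).
-- Summing out n_1 turns the left-hand side into the iterated sum with
--   level 0 = (-q;q^2)_(3M)/(q^6)_(2M),  level ν+1 = Σ_{N≤M} q^(3N²)/(q^6)_(M-N) · level ν at N.
-- Level 0 is closedForm 0 M by splitting (-q;q^2)_(3M) into three (q^6)-Pochhammer
-- symbols and the finite Jacobi triple product.  The Bailey step (level ν ↦ ν+1)
-- exchanges the N- and j-sums and evaluates the inner N-sum (the Bailey kernel) by
-- q-Chu–Vandermonde, which is proved by induction from the q-Pascal rules.

open import Defs
open import Data.Nat using (ℕ; zero; suc)
import Relation.Binary.Reasoning.Setoid as SetoidR

module IntegerSums where

  open import Data.Nat as ℕ using (ℕ; zero; suc; _∸_; _≤_; _<_; z≤n; s≤s)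
  import Data.Nat.Properties as NP
  open import Data.Integer as ℤ using (ℤ; +_)
  import Data.Integer.Properties as ZP
  open import Data.List using (foldr; applyUpTo)
  open import Function using (_∘_)
  open import Relation.Binary.PropositionalEquality
  open import Data.Integer.Tactic.RingSolver using (solve-∀)

  -- Σ n f = f 0 + ... + f (n-1).  Kept opaque so that coefficient
  -- computations are carried out only through the lemmas below.
  opaque
    Σ : ℕ → (ℕ → ℤ) → ℤ
    Σ n f = foldr ℤ._+_ (+ 0) (applyUpTo f n)

  opaque
    unfolding Σ

    Σ-def : ∀ n f → Σ n f ≡ foldr ℤ._+_ (+ 0) (applyUpTo f n)
    Σ-def n f = refl

    Σ-0 : ∀ f → Σ 0 f ≡ + 0
    Σ-0 f = refl

    Σ-suc : ∀ n f → Σ (suc n) f ≡ f 0 ℤ.+ Σ n (f ∘ suc)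
    Σ-suc n f = refl

    Σ-cong : ∀ n {f g} → (∀ i → i < n → f i ≡ g i) → Σ n f ≡ Σ n g
    Σ-cong zero h = refl
    Σ-cong (suc n) {f} {g} h =
      cong₂ ℤ._+_ (h 0 (s≤s z≤n)) (Σ-cong n {f ∘ suc} {g ∘ suc} (λ i i<n → h (suc i) (s≤s i<n)))

    Σ-snoc : ∀ n f → Σ (suc n) f ≡ Σ n f ℤ.+ f n
    Σ-snoc zero f = ZP.+-comm (f 0) (+ 0)
    Σ-snoc (suc n) f = begin
      f 0 ℤ.+ Σ (suc n) (f ∘ suc)            ≡⟨ cong (ℤ._+_ (f 0)) (Σ-snoc n (f ∘ suc)) ⟩
      f 0 ℤ.+ (Σ n (f ∘ suc) ℤ.+ f (suc n))  ≡⟨ sym (ZP.+-assoc (f 0) _ _) ⟩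
      f 0 ℤ.+ Σ n (f ∘ suc) ℤ.+ f (suc n)    ∎
      where open ≡-Reasoning

    Σ-+ : ∀ n f g → Σ n (λ i → f i ℤ.+ g i) ≡ Σ n f ℤ.+ Σ n g
    Σ-+ zero f g = refl
    Σ-+ (suc n) f g = begin
      f 0 ℤ.+ g 0 ℤ.+ Σ n (λ i → f (suc i) ℤ.+ g (suc i))
        ≡⟨ cong (ℤ._+_ (f 0 ℤ.+ g 0)) (Σ-+ n (f ∘ suc) (g ∘ suc)) ⟩
      f 0 ℤ.+ g 0 ℤ.+ (Σ n (f ∘ suc) ℤ.+ Σ n (g ∘ suc))
        ≡⟨ interchange (f 0) (g 0) _ _ ⟩
      f 0 ℤ.+ Σ n (f ∘ suc) ℤ.+ (g 0 ℤ.+ Σ n (g ∘ suc)) ∎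
      where
      open ≡-Reasoning
      interchange : ∀ a b c d → a ℤ.+ b ℤ.+ (c ℤ.+ d) ≡ a ℤ.+ c ℤ.+ (b ℤ.+ d)
      interchange = solve-∀

    Σ-*ˡ : ∀ n c f → c ℤ.* Σ n f ≡ Σ n (λ i → c ℤ.* f i)
    Σ-*ˡ zero c f = ZP.*-zeroʳ c
    Σ-*ˡ (suc n) c f =
      trans (ZP.*-distribˡ-+ c (f 0) _) (cong (ℤ._+_ (c ℤ.* f 0)) (Σ-*ˡ n c (f ∘ suc)))

    Σ-*ʳ : ∀ n c f → Σ n f ℤ.* c ≡ Σ n (λ i → f i ℤ.* c)
    Σ-*ʳ n c f =
      trans (ZP.*-comm (Σ n f) c) (trans (Σ-*ˡ n c f) (Σ-cong n (λ i _ → ZP.*-comm c (f i))))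

    Σ-zero : ∀ n f → (∀ i → i < n → f i ≡ + 0) → Σ n f ≡ + 0
    Σ-zero zero f h = refl
    Σ-zero (suc n) f h =
      cong₂ ℤ._+_ (h 0 (s≤s z≤n)) (Σ-zero n (f ∘ suc) (λ i i<n → h (suc i) (s≤s i<n)))

    Σ-rev : ∀ n f → Σ (suc n) (λ i → f (n ∸ i)) ≡ Σ (suc n) f
    Σ-rev zero f = refl
    Σ-rev (suc n) f = begin
      f (suc n) ℤ.+ Σ (suc n) (λ i → f (n ∸ i)) ≡⟨ cong (ℤ._+_ (f (suc n))) (Σ-rev n f) ⟩
      f (suc n) ℤ.+ Σ (suc n) f                 ≡⟨ ZP.+-comm (f (suc n)) _ ⟩
      Σ (suc n) f ℤ.+ f (suc n)                 ≡⟨ sym (Σ-snoc (suc n) f) ⟩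
      Σ (suc (suc n)) f                         ∎
      where open ≡-Reasoning

    Σ-tri : ∀ N (F : ℕ → ℕ → ℤ) →
      Σ N (λ m → Σ (suc m) (λ i → F i m)) ≡ Σ N (λ i → Σ (N ∸ i) (λ k → F i (i ℕ.+ k)))
    Σ-tri zero F = refl
    Σ-tri (suc N) F = begin
      Σ (suc N) (λ m → Σ (suc m) (λ i → F i m))
        ≡⟨ Σ-snoc N _ ⟩
      Σ N (λ m → Σ (suc m) (λ i → F i m)) ℤ.+ Σ (suc N) (λ i → F i N)
        ≡⟨ cong₂ ℤ._+_ (Σ-tri N F) (Σ-cong (suc N) (λ i i<sN → cong (F i) (sym (NP.m+[n∸m]≡n (NP.<⇒≤pred i<sN))))) ⟩
      Σ N rows ℤ.+ Σ (suc N) diagonal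
        ≡⟨ cong (λ z → z ℤ.+ Σ (suc N) diagonal) extend ⟩
      Σ (suc N) rows ℤ.+ Σ (suc N) diagonal
        ≡⟨ sym (Σ-+ (suc N) rows diagonal) ⟩
      Σ (suc N) (λ i → rows i ℤ.+ diagonal i)
        ≡⟨ Σ-cong (suc N) (λ i i<sN → trans (sym (Σ-snoc (N ∸ i) (λ k → F i (i ℕ.+ k))))
                                             (cong (λ x → Σ x (λ k → F i (i ℕ.+ k))) (sym (NP.+-∸-assoc 1 (NP.<⇒≤pred i<sN))))) ⟩
      Σ (suc N) (λ i → Σ (suc N ∸ i) (λ k → F i (i ℕ.+ k))) ∎
      where
      open ≡-Reasoning
      rows diagonal : ℕ → ℤ
      rows i = Σ (N ∸ i) (λ k → F i (i ℕ.+ k))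
      diagonal i = F i (i ℕ.+ (N ∸ i))
      -- the extra row i = N is empty
      extend : Σ N rows ≡ Σ (suc N) rows
      extend = begin
        Σ N rows                ≡⟨ sym (ZP.+-identityʳ _) ⟩
        Σ N rows ℤ.+ + 0        ≡⟨ cong (λ x → Σ N rows ℤ.+ Σ x (λ k → F N (N ℕ.+ k))) (sym (NP.n∸n≡0 N)) ⟩
        Σ N rows ℤ.+ rows N     ≡⟨ sym (Σ-snoc N rows) ⟩
        Σ (suc N) rows          ∎

    Σ-split : ∀ a b f → Σ (a ℕ.+ b) f ≡ Σ a f ℤ.+ Σ b (λ k → f (a ℕ.+ k))
    Σ-split zero b f = sym (ZP.+-identityˡ _)
    Σ-split (suc a) b f =
      trans (cong (ℤ._+_ (f 0)) (Σ-split a b (f ∘ suc))) (sym (ZP.+-assoc (f 0) _ _))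

module SeriesRing where

  open import Defs
  open IntegerSums
  open import Data.Nat as ℕ using (ℕ; suc; _∸_; _≤_; _<_; z≤n; s≤s)
  import Data.Nat.Properties as NP
  open import Data.Integer as ℤ using (ℤ; +_)
  import Data.Integer.Properties as ZP
  open import Data.List using (foldr)
  open import Data.List.Properties using (map-upTo)
  open import Data.Product using (_,_)
  open import Relation.Binary.PropositionalEquality
  open import Relation.Nullary using (yes; no; ¬_)
  open import Data.Empty using (⊥-elim)
  open import Algebra.Bundles using (CommutativeRing; RawRing)
  open import Relation.Binary.Definitions using (WeaklyDecidable)
  open import Relation.Binary.Structures using (IsEquivalence)
  import Algebra.Solver.Ring.AlmostCommutativeRing as ACR
  open import Data.Maybe using (just; nothing)
  open import Data.Sum using (inj₁; inj₂)

  *s-coef : ∀ f g n → (f *s g) n ≡ Σ (suc n) (λ i → f i ℤ.* g (n ∸ i))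
  *s-coef f g n = trans (cong (foldr ℤ._+_ (+ 0)) (map-upTo (λ i → f i ℤ.* g (n ∸ i)) (suc n))) (sym (Σ-def (suc n) (λ i → f i ℤ.* g (n ∸ i))))

  -s_ : Series → Series
  (-s f) n = ℤ.- f n

  *s-cong : ∀ {f f' g g'} → f ≈s f' → g ≈s g' → (f *s g) ≈s (f' *s g')
  *s-cong {f} {f'} {g} {g'} p q n = trans (*s-coef f g n) (trans (Σ-cong (suc n) (λ i _ → cong₂ ℤ._*_ (p i) (q (n ∸ i)))) (sym (*s-coef f' g' n)))

  *s-comm : ∀ f g → (f *s g) ≈s (g *s f)
  *s-comm f g n = begin
    (f *s g) n ≡⟨ *s-coef f g n ⟩
    Σ (suc n) (λ i → f i ℤ.* g (n ∸ i)) ≡⟨ sym (Σ-rev n (λ i → f i ℤ.* g (n ∸ i))) ⟩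
    Σ (suc n) (λ i → f (n ∸ i) ℤ.* g (n ∸ (n ∸ i)))
      ≡⟨ Σ-cong (suc n) (λ i i<sn → trans (cong (λ x → f (n ∸ i) ℤ.* g x) (NP.m∸[m∸n]≡n (NP.<⇒≤pred i<sn))) (ZP.*-comm (f (n ∸ i)) (g i))) ⟩
    Σ (suc n) (λ i → g i ℤ.* f (n ∸ i)) ≡⟨ sym (*s-coef g f n) ⟩
    (g *s f) n ∎
    where open ≡-Reasoning

  *s-distribˡ : ∀ f g h → (f *s (g +s h)) ≈s ((f *s g) +s (f *s h))
  *s-distribˡ f g h n = begin
    (f *s (g +s h)) n ≡⟨ *s-coef f (g +s h) n ⟩
    Σ (suc n) (λ i → f i ℤ.* (g (n ∸ i) ℤ.+ h (n ∸ i)))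
      ≡⟨ Σ-cong (suc n) (λ i _ → ZP.*-distribˡ-+ (f i) _ _) ⟩
    Σ (suc n) (λ i → f i ℤ.* g (n ∸ i) ℤ.+ f i ℤ.* h (n ∸ i)) ≡⟨ Σ-+ (suc n) (λ i → f i ℤ.* g (n ∸ i)) (λ i → f i ℤ.* h (n ∸ i)) ⟩
    Σ (suc n) (λ i → f i ℤ.* g (n ∸ i)) ℤ.+ Σ (suc n) (λ i → f i ℤ.* h (n ∸ i))
      ≡⟨ sym (cong₂ ℤ._+_ (*s-coef f g n) (*s-coef f h n)) ⟩
    ((f *s g) +s (f *s h)) n ∎
    where open ≡-Reasoning

  *s-assoc : ∀ f g h → ((f *s g) *s h) ≈s (f *s (g *s h))
  *s-assoc f g h n = begin
    ((f *s g) *s h) n ≡⟨ *s-coef (f *s g) h n ⟩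
    Σ (suc n) (λ m → (f *s g) m ℤ.* h (n ∸ m))
      ≡⟨ Σ-cong (suc n) (λ m _ → trans (cong (ℤ._* h (n ∸ m)) (*s-coef f g m)) (Σ-*ʳ (suc m) (h (n ∸ m)) (λ i → f i ℤ.* g (m ∸ i)))) ⟩
    Σ (suc n) (λ m → Σ (suc m) (λ i → f i ℤ.* g (m ∸ i) ℤ.* h (n ∸ m)))
      ≡⟨ Σ-tri (suc n) (λ i m → f i ℤ.* g (m ∸ i) ℤ.* h (n ∸ m)) ⟩
    Σ (suc n) (λ i → Σ (suc n ∸ i) (λ k → f i ℤ.* g ((i ℕ.+ k) ∸ i) ℤ.* h (n ∸ (i ℕ.+ k))))
      ≡⟨ Σ-cong (suc n) (λ i i<sn → inner i (NP.<⇒≤pred i<sn)) ⟩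
    Σ (suc n) (λ i → f i ℤ.* (g *s h) (n ∸ i)) ≡⟨ sym (*s-coef f (g *s h) n) ⟩
    (f *s (g *s h)) n ∎
    where
    open ≡-Reasoning
    inner : ∀ i → i ≤ n → Σ (suc n ∸ i) (λ k → f i ℤ.* g ((i ℕ.+ k) ∸ i) ℤ.* h (n ∸ (i ℕ.+ k)))
                           ≡ f i ℤ.* (g *s h) (n ∸ i)
    inner i i≤n = begin
      Σ (suc n ∸ i) (λ k → f i ℤ.* g ((i ℕ.+ k) ∸ i) ℤ.* h (n ∸ (i ℕ.+ k)))
        ≡⟨ cong (λ x → Σ x (λ k → f i ℤ.* g ((i ℕ.+ k) ∸ i) ℤ.* h (n ∸ (i ℕ.+ k)))) (NP.+-∸-assoc 1 i≤n) ⟩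
      Σ (suc (n ∸ i)) (λ k → f i ℤ.* g ((i ℕ.+ k) ∸ i) ℤ.* h (n ∸ (i ℕ.+ k)))
        ≡⟨ Σ-cong (suc (n ∸ i)) (λ k _ → trans (ZP.*-assoc (f i) _ _)
             (cong₂ (λ a b → f i ℤ.* (g a ℤ.* h b)) (NP.m+n∸m≡n i k) (sym (NP.∸-+-assoc n i k)))) ⟩
      Σ (suc (n ∸ i)) (λ k → f i ℤ.* (g k ℤ.* h ((n ∸ i) ∸ k)))
        ≡⟨ sym (Σ-*ˡ (suc (n ∸ i)) (f i) (λ k → g k ℤ.* h ((n ∸ i) ∸ k))) ⟩
      f i ℤ.* Σ (suc (n ∸ i)) (λ k → g k ℤ.* h ((n ∸ i) ∸ k))
        ≡⟨ cong (f i ℤ.*_) (sym (*s-coef g h (n ∸ i))) ⟩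
      f i ℤ.* (g *s h) (n ∸ i) ∎

  qpow-≡ : ∀ k → qpow k k ≡ + 1
  qpow-≡ k with k ℕ.≟ k
  ... | yes _ = refl
  ... | no ne = ⊥-elim (ne refl)

  qpow-≢ : ∀ k i → ¬ k ≡ i → qpow k i ≡ + 0
  qpow-≢ k i ne with k ℕ.≟ i
  ... | yes e = ⊥-elim (ne e)
  ... | no _ = refl

  Σ-delta-lo : ∀ N k (h : ℕ → ℤ) → N ≤ k → Σ N (λ i → qpow k i ℤ.* h i) ≡ + 0
  Σ-delta-lo N k h N≤k = Σ-zero N (λ i → qpow k i ℤ.* h i) (λ i i<N → cong (ℤ._* h i) (qpow-≢ k i (λ e → NP.<-irrefl (sym e) (NP.<-≤-trans i<N N≤k))))

  Σ-delta-hi : ∀ N k (h : ℕ → ℤ) → k < N → Σ N (λ i → qpow k i ℤ.* h i) ≡ h k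
  Σ-delta-hi (suc N) k h k<sN with NP.m≤n⇒m<n∨m≡n (NP.<⇒≤pred k<sN)
  ... | inj₁ k<N = trans (Σ-snoc N (λ i → qpow k i ℤ.* h i)) (trans (cong₂ ℤ._+_ (Σ-delta-hi N k h k<N) (cong (ℤ._* h N) (qpow-≢ k N (λ e → NP.<-irrefl e k<N)))) (ZP.+-identityʳ (h k)))
  ... | inj₂ refl = trans (Σ-snoc N (λ i → qpow N i ℤ.* h i)) (trans (cong₂ ℤ._+_ (Σ-delta-lo N N h NP.≤-refl) (trans (cong (ℤ._* h N) (qpow-≡ N)) (ZP.*-identityˡ (h N)))) (ZP.+-identityˡ (h N)))

  qpow-*-hi : ∀ k f n → k ≤ n → (qpow k *s f) n ≡ f (n ∸ k)
  qpow-*-hi k f n k≤n = trans (*s-coef (qpow k) f n) (Σ-delta-hi (suc n) k (λ i → f (n ∸ i)) (s≤s k≤n))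

  qpow-*-lo : ∀ k f n → n < k → (qpow k *s f) n ≡ + 0
  qpow-*-lo k f n n<k = trans (*s-coef (qpow k) f n) (Σ-delta-lo (suc n) k (λ i → f (n ∸ i)) n<k)

  *s-identityˡ : ∀ f → (1s *s f) ≈s f
  *s-identityˡ f n = qpow-*-hi 0 f n z≤n

  qpow-+ : ∀ a b → (qpow a *s qpow b) ≈s qpow (a ℕ.+ b)
  qpow-+ a b n with a ℕ.≤? n
  ... | yes a≤n = trans (qpow-*-hi a (qpow b) n a≤n) shifted
    where
    shifted : qpow b (n ∸ a) ≡ qpow (a ℕ.+ b) n
    shifted with b ℕ.≟ (n ∸ a) | (a ℕ.+ b) ℕ.≟ n
    ... | yes _ | yes _ = refl
    ... | no _ | no _ = refl
    ... | yes e | no ne = ⊥-elim (ne (trans (cong (a ℕ.+_) e) (NP.m+[n∸m]≡n a≤n)))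
    ... | no ne | yes e = ⊥-elim (ne (trans (sym (NP.m+n∸m≡n a b)) (cong (_∸ a) e)))
  ... | no a≰n = trans (qpow-*-lo a (qpow b) n (NP.≰⇒> a≰n)) (sym (qpow-≢ (a ℕ.+ b) n (λ e → a≰n (NP.≤-trans (NP.m≤m+n a b) (NP.≤-reflexive e)))))

  ·s-*s : ∀ c f g → ((c ·s f) *s g) ≈s (c ·s (f *s g))
  ·s-*s c f g n = trans (*s-coef (c ·s f) g n) (trans (Σ-cong (suc n) (λ i _ → ZP.*-assoc c (f i) _)) (trans (sym (Σ-*ˡ (suc n) c (λ i → f i ℤ.* g (n ∸ i)))) (cong (c ℤ.*_) (sym (*s-coef f g n)))))

  -- The wrapper
  -- and the opaque operations below keep the ring solver from unfolding
  -- series into functions; all reasoning about series then happens in the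
  -- commutative ring seriesRing.
  data S : Set where
    ⟨_⟩ : Series → S

  un : S → Series
  un ⟨ f ⟩ = f

  record _≈_ (x y : S) : Set where
    constructor mk≈
    field pt : un x ≈s un y
  open _≈_ public

  infix 4 _≈_

  ≈-isEquivalence : IsEquivalence _≈_
  ≈-isEquivalence = record { refl = mk≈ (λ _ → refl) ; sym = λ p → mk≈ (λ n → sym (pt p n)) ; trans = λ p q → mk≈ (λ n → trans (pt p n) (pt q n)) }

  opaque
    _⊕_ : S → S → S
    ⟨ f ⟩ ⊕ ⟨ g ⟩ = ⟨ f +s g ⟩
    _⊗_ : S → S → S
    ⟨ f ⟩ ⊗ ⟨ g ⟩ = ⟨ f *s g ⟩
    ⊖_ : S → S
    ⊖ ⟨ f ⟩ = ⟨ -s f ⟩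
    𝟘 𝟙 : S
    𝟘 = ⟨ 0s ⟩
    𝟙 = ⟨ 1s ⟩

    ⊕-def : ∀ f g → ⟨ f ⟩ ⊕ ⟨ g ⟩ ≈ ⟨ f +s g ⟩
    ⊕-def f g = mk≈ (λ _ → refl)
    ⊗-def : ∀ f g → ⟨ f ⟩ ⊗ ⟨ g ⟩ ≈ ⟨ f *s g ⟩
    ⊗-def f g = mk≈ (λ _ → refl)
    ⊖-def : ∀ f → ⊖ ⟨ f ⟩ ≈ ⟨ -s f ⟩
    ⊖-def f = mk≈ (λ _ → refl)
    𝟘-def : ⟨ 0s ⟩ ≈ 𝟘
    𝟘-def = mk≈ (λ _ → refl)
    𝟙-def : ⟨ 1s ⟩ ≈ 𝟙
    𝟙-def = mk≈ (λ _ → refl)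
    ⊕-cong : ∀ {x y u v} → x ≈ y → u ≈ v → (x ⊕ u) ≈ (y ⊕ v)
    ⊕-cong {⟨ _ ⟩} {⟨ _ ⟩} {⟨ _ ⟩} {⟨ _ ⟩} p q = mk≈ (λ n → cong₂ ℤ._+_ (pt p n) (pt q n))
    ⊗-cong : ∀ {x y u v} → x ≈ y → u ≈ v → (x ⊗ u) ≈ (y ⊗ v)
    ⊗-cong {⟨ _ ⟩} {⟨ _ ⟩} {⟨ _ ⟩} {⟨ _ ⟩} p q = mk≈ (*s-cong (pt p) (pt q))
    ⊖-cong : ∀ {x y} → x ≈ y → (⊖ x) ≈ (⊖ y)
    ⊖-cong {⟨ _ ⟩} {⟨ _ ⟩} p = mk≈ (λ n → cong ℤ.-_ (pt p n))
    ⊕-assoc : ∀ x y z → ((x ⊕ y) ⊕ z) ≈ (x ⊕ (y ⊕ z))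
    ⊕-assoc ⟨ f ⟩ ⟨ g ⟩ ⟨ h ⟩ = mk≈ (λ n → ZP.+-assoc (f n) (g n) (h n))
    ⊕-idl : ∀ x → (𝟘 ⊕ x) ≈ x
    ⊕-idl ⟨ f ⟩ = mk≈ (λ n → ZP.+-identityˡ (f n))
    ⊕-idr : ∀ x → (x ⊕ 𝟘) ≈ x
    ⊕-idr ⟨ f ⟩ = mk≈ (λ n → ZP.+-identityʳ (f n))
    ⊖-invl : ∀ x → ((⊖ x) ⊕ x) ≈ 𝟘
    ⊖-invl ⟨ f ⟩ = mk≈ (λ n → ZP.+-inverseˡ (f n))
    ⊖-invr : ∀ x → (x ⊕ (⊖ x)) ≈ 𝟘
    ⊖-invr ⟨ f ⟩ = mk≈ (λ n → ZP.+-inverseʳ (f n))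
    ⊕-comm : ∀ x y → (x ⊕ y) ≈ (y ⊕ x)
    ⊕-comm ⟨ f ⟩ ⟨ g ⟩ = mk≈ (λ n → ZP.+-comm (f n) (g n))
    ⊗-assoc : ∀ x y z → ((x ⊗ y) ⊗ z) ≈ (x ⊗ (y ⊗ z))
    ⊗-assoc ⟨ f ⟩ ⟨ g ⟩ ⟨ h ⟩ = mk≈ (*s-assoc f g h)
    ⊗-comm : ∀ x y → (x ⊗ y) ≈ (y ⊗ x)
    ⊗-comm ⟨ f ⟩ ⟨ g ⟩ = mk≈ (*s-comm f g)
    ⊗-idl : ∀ x → (𝟙 ⊗ x) ≈ x
    ⊗-idl ⟨ f ⟩ = mk≈ (*s-identityˡ f)
    ⊗-idr : ∀ x → (x ⊗ 𝟙) ≈ x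
    ⊗-idr ⟨ f ⟩ = mk≈ (λ n → trans (*s-comm f 1s n) (*s-identityˡ f n))
    distl : ∀ x y z → (x ⊗ (y ⊕ z)) ≈ ((x ⊗ y) ⊕ (x ⊗ z))
    distl ⟨ f ⟩ ⟨ g ⟩ ⟨ h ⟩ = mk≈ (*s-distribˡ f g h)
    distr : ∀ x y z → ((y ⊕ z) ⊗ x) ≈ ((y ⊗ x) ⊕ (z ⊗ x))
    distr ⟨ f ⟩ ⟨ g ⟩ ⟨ h ⟩ = mk≈ (λ n → trans (*s-comm (g +s h) f n) (trans (*s-distribˡ f g h n) (cong₂ ℤ._+_ (*s-comm f g n) (*s-comm f h n))))

  seriesRing : CommutativeRing _ _
  seriesRing = record
    { Carrier = S ; _≈_ = _≈_ ; _+_ = _⊕_ ; _*_ = _⊗_ ; -_ = ⊖_ ; 0# = 𝟘 ; 1# = 𝟙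
    ; isCommutativeRing = record
      { isRing = record
        { +-isAbelianGroup = record
          { isGroup = record
            { isMonoid = record
              { isSemigroup = record
                { isMagma = record { isEquivalence = ≈-isEquivalence ; ∙-cong = ⊕-cong }
                ; assoc = ⊕-assoc }
              ; identity = ⊕-idl , ⊕-idr }
            ; inverse = ⊖-invl , ⊖-invr
            ; ⁻¹-cong = ⊖-cong }
          ; comm = ⊕-comm }
        ; *-cong = ⊗-cong
        ; *-assoc = ⊗-assoc
        ; *-identity = ⊗-idl , ⊗-idr
        ; distrib = distl , distr }
      ; *-comm = ⊗-comm } }

  seriesAlmostRing : ACR.AlmostCommutativeRing _ _
  seriesAlmostRing = ACR.fromCommutativeRing seriesRing

  ℤ-rawRing : RawRing _ _
  ℤ-rawRing = CommutativeRing.rawRing ZP.+-*-commutativeRing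

  κ : ℤ → S
  κ c = ⟨ c ·s 1s ⟩

  constants : ℤ-rawRing ACR.-Raw-AlmostCommutative⟶ seriesAlmostRing
  constants = record
    { ⟦_⟧ = κ
    ; +-homo = λ a b → ≈t (mk≈ (λ n → ZP.*-distribʳ-+ (1s n) a b)) (≈s (⊕-def (a ·s 1s) (b ·s 1s)))
    ; *-homo = λ a b → ≈t (mk≈ (λ n → trans (ZP.*-assoc a b (1s n)) (sym (trans (·s-*s a 1s (b ·s 1s) n) (cong (a ℤ.*_) (*s-identityˡ (b ·s 1s) n)))))) (≈s (⊗-def (a ·s 1s) (b ·s 1s)))
    ; -‿homo = λ a → ≈t (mk≈ (λ n → sym (ZP.neg-distribˡ-* a (1s n)))) (≈s (⊖-def (a ·s 1s)))
    ; 0-homo = ≈t (mk≈ (λ n → ZP.*-zeroˡ (1s n))) 𝟘-def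
    ; 1-homo = ≈t (mk≈ (λ n → ZP.*-identityˡ (1s n))) 𝟙-def }
    where
    ≈t = IsEquivalence.trans ≈-isEquivalence
    ≈s = IsEquivalence.sym ≈-isEquivalence

  coeff≟ : WeaklyDecidable (ACR.Induced-equivalence constants)
  coeff≟ a b with a ZP.≟ b
  ... | yes refl = just (mk≈ (λ _ → refl))
  ... | no _ = nothing

  open import Algebra.Solver.Ring ℤ-rawRing seriesAlmostRing constants coeff≟ public

module SeriesSums where

  open import Defs
  open IntegerSums
  open SeriesRing
  open import Data.Nat as ℕ using (ℕ; zero; suc; _∸_; _≤_; _<_; s≤s)
  import Data.Nat.Properties as NP
  open import Data.Integer as ℤ using (+_)
  open import Data.List using (List; []; _∷_; map; upTo; applyUpTo; concatMap; _++_)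
  import Data.List.Properties as LP
  open import Function using (_∘_)
  open import Relation.Binary.PropositionalEquality as P using (_≡_)
  open import Algebra.Bundles using (CommutativeRing)
  open CommutativeRing seriesRing public using (_+_; _*_; -_; _-_; 0#; 1#; +-cong; *-cong; +-comm; *-comm; +-assoc; *-assoc; distribˡ; distribʳ; +-identityˡ; +-identityʳ; *-identityˡ; *-identityʳ; zeroˡ; zeroʳ; setoid; -‿cong) renaming (refl to ≈refl; sym to ≈sym; trans to ≈trans)
  import Relation.Binary.Reasoning.Setoid as SetoidR

  opaque
    ΣS : ℕ → (ℕ → S) → S
    ΣS n f = ⟨ (λ i → Σ n (λ k → un (f k) i)) ⟩

  opaque
    unfolding ΣS

    ΣS-cong : ∀ n {f g} → (∀ k → k < n → f k ≈ g k) → ΣS n f ≈ ΣS n g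
    ΣS-cong n h = mk≈ λ i → Σ-cong n (λ k k<n → pt (h k k<n) i)

    ΣS-cong' : ∀ n {f g} → (∀ k → f k ≈ g k) → ΣS n f ≈ ΣS n g
    ΣS-cong' n h = ΣS-cong n (λ k _ → h k)

    ΣS-0 : ∀ f → ΣS 0 f ≈ 0#
    ΣS-0 f = ≈trans (mk≈ λ i → Σ-0 (λ k → un (f k) i)) 𝟘-def

    wrap : ∀ x → ⟨ un x ⟩ ≈ x
    wrap ⟨ f ⟩ = ≈refl

    ⊕-un : ∀ x y → ⟨ un x +s un y ⟩ ≈ x + y
    ⊕-un ⟨ f ⟩ ⟨ g ⟩ = ≈sym (⊕-def f g)

    ΣS-suc : ∀ n f → ΣS (suc n) f ≈ f 0 + ΣS n (f ∘ suc)
    ΣS-suc n f = ≈trans (mk≈ λ i → Σ-suc n (λ k → un (f k) i)) (⊕-un (f 0) (ΣS n (f ∘ suc)))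

    ΣS-snoc : ∀ n f → ΣS (suc n) f ≈ ΣS n f + f n
    ΣS-snoc n f = ≈trans (mk≈ λ i → Σ-snoc n (λ k → un (f k) i)) (⊕-un (ΣS n f) (f n))

    ΣS-+ : ∀ n f g → ΣS n (λ k → f k + g k) ≈ ΣS n f + ΣS n g
    ΣS-+ n f g = ≈trans (ΣS-cong' n (λ k → ≈sym (⊕-un (f k) (g k)))) (≈trans (mk≈ λ i → Σ-+ n (λ k → un (f k) i) (λ k → un (g k) i)) (⊕-un (ΣS n f) (ΣS n g)))

    ΣS-zero : ∀ n f → (∀ k → k < n → f k ≈ 0#) → ΣS n f ≈ 0#
    ΣS-zero n f h = ≈trans (mk≈ λ i → Σ-zero n (λ k → un (f k) i) (λ k k<n → P.trans (pt (h k k<n) i) (pt (≈sym 𝟘-def) i))) 𝟘-def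

    ΣS-split : ∀ a b f → ΣS (a ℕ.+ b) f ≈ ΣS a f + ΣS b (λ k → f (a ℕ.+ k))
    ΣS-split a b f = ≈trans (mk≈ λ i → Σ-split a b (λ k → un (f k) i)) (⊕-un (ΣS a f) (ΣS b (λ k → f (a ℕ.+ k))))

    ΣS-*ʳ : ∀ n f g → ΣS n f * g ≈ ΣS n (λ k → f k * g)
    ΣS-*ʳ zero f g = ≈trans (*-cong (ΣS-0 f) ≈refl) (≈trans (zeroˡ g) (≈sym (ΣS-0 (λ k → f k * g))))
    ΣS-*ʳ (suc n) f g = begin
      ΣS (suc n) f * g ≈⟨ *-cong (ΣS-suc n f) ≈refl ⟩
      (f 0 + ΣS n (f ∘ suc)) * g ≈⟨ distribʳ g (f 0) (ΣS n (f ∘ suc)) ⟩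
      f 0 * g + ΣS n (f ∘ suc) * g ≈⟨ +-cong ≈refl (ΣS-*ʳ n (f ∘ suc) g) ⟩
      f 0 * g + ΣS n (λ k → f (suc k) * g) ≈⟨ ≈sym (ΣS-suc n (λ k → f k * g)) ⟩
      ΣS (suc n) (λ k → f k * g) ∎
      where open SetoidR setoid

    ΣS-*ˡ : ∀ n f g → g * ΣS n f ≈ ΣS n (λ k → g * f k)
    ΣS-*ˡ n f g = ≈trans (*-comm g (ΣS n f)) (≈trans (ΣS-*ʳ n f g) (ΣS-cong' n (λ k → *-comm (f k) g)))

  opaque
    unfolding ΣS
    sumS-upTo : ∀ n f → ⟨ sumS (map f (upTo n)) ⟩ ≈ ΣS n (λ k → ⟨ f k ⟩)
    sumS-upTo n f = mk≈ λ i → P.trans (P.cong (λ l → sumS l i) (LP.map-upTo f n)) (coefficients n f i)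
      where
      coefficients : ∀ n f i → sumS (applyUpTo f n) i ≡ Σ n (λ k → f k i)
      coefficients zero f i = P.sym (Σ-0 (λ k → f k i))
      coefficients (suc n) f i = P.trans (P.cong (λ z → f 0 i ℤ.+ z) (coefficients n (f ∘ suc) i)) (P.sym (Σ-suc n (λ k → f k i)))

  sumS-cons : ∀ x xs → ⟨ sumS (x ∷ xs) ⟩ ≈ ⟨ x ⟩ + ⟨ sumS xs ⟩
  sumS-cons x xs = ≈sym (⊕-def x (sumS xs))

  prodS-cons : ∀ x xs → ⟨ prodS (x ∷ xs) ⟩ ≈ ⟨ x ⟩ * ⟨ prodS xs ⟩
  prodS-cons x xs = ≈sym (⊗-def x (prodS xs))

  prodS-map-cong : ∀ (xs : List ℕ) {f g : ℕ → Series} → (∀ k → ⟨ f k ⟩ ≈ ⟨ g k ⟩) → ⟨ prodS (map f xs) ⟩ ≈ ⟨ prodS (map g xs) ⟩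
  prodS-map-cong [] h = ≈refl
  prodS-map-cong (x ∷ xs) {f} {g} h = ≈trans (prodS-cons (f x) (map f xs)) (≈trans (*-cong (h x) (prodS-map-cong xs h)) (≈sym (prodS-cons (g x) (map g xs))))

  prodS-map-* : ∀ (xs : List ℕ) (f g : ℕ → Series) → ⟨ prodS (map f xs) ⟩ * ⟨ prodS (map g xs) ⟩ ≈ ⟨ prodS (map (λ k → f k *s g k) xs) ⟩
  prodS-map-* [] f g = ≈trans (*-cong 𝟙-def 𝟙-def) (≈trans (*-identityˡ 1#) (≈sym 𝟙-def))
  prodS-map-* (x ∷ xs) f g = begin
    ⟨ prodS (map f (x ∷ xs)) ⟩ * ⟨ prodS (map g (x ∷ xs)) ⟩ ≈⟨ *-cong (prodS-cons (f x) (map f xs)) (prodS-cons (g x) (map g xs)) ⟩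
    (⟨ f x ⟩ * ⟨ prodS (map f xs) ⟩) * (⟨ g x ⟩ * ⟨ prodS (map g xs) ⟩) ≈⟨ interchange ⟨ f x ⟩ ⟨ prodS (map f xs) ⟩ ⟨ g x ⟩ ⟨ prodS (map g xs) ⟩ ⟩
    (⟨ f x ⟩ * ⟨ g x ⟩) * (⟨ prodS (map f xs) ⟩ * ⟨ prodS (map g xs) ⟩) ≈⟨ *-cong ≈refl (prodS-map-* xs f g) ⟩
    ⟨ f x ⟩ * ⟨ g x ⟩ * ⟨ prodS (map (λ k → f k *s g k) xs) ⟩ ≈⟨ *-cong (⊗-def (f x) (g x)) ≈refl ⟩
    ⟨ f x *s g x ⟩ * ⟨ prodS (map (λ k → f k *s g k) xs) ⟩ ≈⟨ ≈sym (prodS-cons (f x *s g x) (map (λ k → f k *s g k) xs)) ⟩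
    ⟨ prodS (map (λ k → f k *s g k) (x ∷ xs)) ⟩ ∎
    where
    open SetoidR setoid
    interchange : ∀ a b c d → (a * b) * (c * d) ≈ (a * c) * (b * d)
    interchange = solve 4 (λ a b c d → (a :* b) :* (c :* d) := (a :* c) :* (b :* d)) ≈refl

  prodS-ones : ∀ (xs : List ℕ) → ⟨ prodS (map (λ _ → 1s) xs) ⟩ ≈ 1#
  prodS-ones [] = 𝟙-def
  prodS-ones (x ∷ xs) = ≈trans (prodS-cons 1s (map (λ _ → 1s) xs)) (≈trans (*-cong 𝟙-def (prodS-ones xs)) (*-identityˡ 1#))

  lift : ∀ f g → f ≈s g → ⟨ f ⟩ ≈ ⟨ g ⟩
  lift f g = mk≈

  ≈≡ : ∀ {x y} → x ≡ y → x ≈ y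
  ≈≡ P.refl = ≈refl

  ΣS-count : ∀ {a b} f → a ≡ b → ΣS a f ≈ ΣS b f
  ΣS-count f P.refl = ≈refl

  listSum : ∀ {A : Set} → List A → (A → S) → S
  listSum [] g = 0#
  listSum (x ∷ xs) g = g x + listSum xs g

  listSum-link : ∀ {A : Set} (L : List A) (f : A → Series) → ⟨ sumS (map f L) ⟩ ≈ listSum L (λ v → ⟨ f v ⟩)
  listSum-link [] f = 𝟘-def
  listSum-link (x ∷ xs) f = ≈trans (sumS-cons (f x) (map f xs)) (+-cong ≈refl (listSum-link xs f))

  listSum-cong : ∀ {A : Set} (L : List A) {g h : A → S} → (∀ v → g v ≈ h v) → listSum L g ≈ listSum L h
  listSum-cong [] e = ≈refl
  listSum-cong (x ∷ xs) e = +-cong (e x) (listSum-cong xs e)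

  listSum-++ : ∀ {A : Set} (L K : List A) g → listSum (L ++ K) g ≈ listSum L g + listSum K g
  listSum-++ [] K g = ≈sym (+-identityˡ _)
  listSum-++ (x ∷ L) K g = ≈trans (+-cong ≈refl (listSum-++ L K g)) (≈sym (+-assoc _ _ _))

  listSum-map : ∀ {A B : Set} (L : List A) (f : A → B) g → listSum (map f L) g ≈ listSum L (g ∘ f)
  listSum-map [] f g = ≈refl
  listSum-map (x ∷ L) f g = +-cong ≈refl (listSum-map L f g)

  listSum-concatMap : ∀ {A B : Set} (L : List A) (F : A → List B) g → listSum (concatMap F L) g ≈ listSum L (λ x → listSum (F x) g)
  listSum-concatMap [] F g = ≈refl
  listSum-concatMap (x ∷ L) F g = ≈trans (listSum-++ (F x) (concatMap F L) g) (+-cong ≈refl (listSum-concatMap L F g))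

  listSum-upTo : ∀ n (g : ℕ → S) → listSum (upTo n) g ≈ ΣS n g
  listSum-upTo n g = ≈trans (≈≡ (P.cong (λ l → listSum l g) (P.sym (LP.map-id (upTo n))))) (≈trans (≈sym (sumS-as-listSum (upTo n))) (≈trans (sumS-upTo n (λ k → un (g k))) (ΣS-cong' n (λ k → wrap (g k)))))
    where
    sumS-as-listSum : ∀ (L : List ℕ) → ⟨ sumS (map (λ k → un (g k)) L) ⟩ ≈ listSum (map (λ x → x) L) g
    sumS-as-listSum [] = 𝟘-def
    sumS-as-listSum (x ∷ L) = ≈trans (sumS-cons (un (g x)) (map (λ k → un (g k)) L)) (+-cong (wrap (g x)) (sumS-as-listSum L))

  listSum-*ʳ : ∀ {A : Set} (L : List A) g c → listSum L g * c ≈ listSum L (λ v → g v * c)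
  listSum-*ʳ [] g c = zeroˡ c
  listSum-*ʳ (x ∷ L) g c = ≈trans (distribʳ c _ _) (+-cong ≈refl (listSum-*ʳ L g c))

  listSum-*ˡ : ∀ {A : Set} (L : List A) g c → c * listSum L g ≈ listSum L (λ v → c * g v)
  listSum-*ˡ L g c = ≈trans (*-comm _ _) (≈trans (listSum-*ʳ L g c) (listSum-cong L (λ v → *-comm _ _)))

  listSum-ΣS : ∀ {A : Set} (L : List A) n (F : ℕ → A → S) → ΣS n (λ k → listSum L (F k)) ≈ listSum L (λ v → ΣS n (λ k → F k v))
  listSum-ΣS [] n F = ΣS-zero n _ (λ _ _ → ≈refl)
  listSum-ΣS (x ∷ L) n F = ≈trans (ΣS-+ n (λ k → F k x) (λ k → listSum L (F k))) (+-cong ≈refl (listSum-ΣS L n F))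

  ΣS-trunc : ∀ B M f → M ≤ B → (∀ k → M < k → f k ≈ 0#) → ΣS (suc B) f ≈ ΣS (suc M) f
  ΣS-trunc B M f M≤B z = ≈trans (ΣS-count f (P.cong suc (P.sym (NP.m+[n∸m]≡n M≤B))))
    (≈trans (ΣS-split (suc M) (B ∸ M) f) (≈trans (+-cong ≈refl (ΣS-zero (B ∸ M) _ (λ k _ → z (suc M ℕ.+ k) (s≤s (NP.m≤m+n M k))))) (+-identityʳ _)))

module QFactorials where

  open import Defs
  open SeriesRing
  open SeriesSums
  open import Data.Nat as ℕ using (ℕ; zero; suc; _∸_; _≤_; _<_; z≤n; s≤s)
  import Data.Nat.Properties as NP
  open import Data.Nat.Divisibility as ND using (_∣_; _∣?_)
  open import Data.Integer as ℤ using (ℤ; +_)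
  import Data.Integer.Properties as ZP
  open import Data.List using (map; upTo; applyUpTo)
  import Data.List.Properties as LP
  open import Function using (_∘_)
  open import Relation.Binary.PropositionalEquality as P using (_≡_)
  open import Relation.Nullary using (yes; no)
  open import Relation.Binary.Definitions using (tri<; tri≈; tri>)
  open import Data.Empty using (⊥-elim)
  open import Data.Product using (_,_)
  import Relation.Binary.Reasoning.Setoid as SetoidR
  open import Data.Nat.Tactic.RingSolver using (solve-∀)

  opaque
    Q : ℕ → S
    Q k = ⟨ qpow k ⟩

  Q-cong : ∀ {a b} → a ≡ b → Q a ≈ Q b
  Q-cong P.refl = ≈refl

  opaque
    unfolding Q
    Q-+ : ∀ a b → Q a * Q b ≈ Q (a ℕ.+ b)
    Q-+ a b = ≈trans (⊗-def (qpow a) (qpow b)) (mk≈ (qpow-+ a b))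

  opaque
    unfolding Q
    Q-0 : Q 0 ≈ 1#
    Q-0 = 𝟙-def

  fac : ℤ → ℕ → S
  fac c e = κ (+ 1) - κ c * Q e

  opaque
    unfolding Q
    fac-def : ∀ c e → ⟨ 1s +s (ℤ.- c) ·s qpow e ⟩ ≈ fac c e
    fac-def c e = begin
      ⟨ 1s +s (ℤ.- c) ·s qpow e ⟩ ≈⟨ mk≈ (λ n → P.cong (λ z → 1s n ℤ.+ z) (P.sym (ZP.neg-distribˡ-* c (qpow e n)))) ⟩
      ⟨ 1s +s (-s (c ·s qpow e)) ⟩ ≈⟨ ≈sym (⊕-def 1s (-s (c ·s qpow e))) ⟩
      ⟨ 1s ⟩ + ⟨ -s (c ·s qpow e) ⟩ ≈⟨ +-cong (lift 1s ((+ 1) ·s 1s) (λ n → P.sym (ZP.*-identityˡ (1s n)))) (≈sym (⊖-def (c ·s qpow e))) ⟩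
      κ (+ 1) - ⟨ c ·s qpow e ⟩ ≈⟨ +-cong ≈refl (-‿cong (≈sym kq)) ⟩
      fac c e ∎
      where
      open SetoidR setoid
      kq : κ c * Q e ≈ ⟨ c ·s qpow e ⟩
      kq = ≈trans (⊗-def (c ·s 1s) (qpow e)) (≈trans (lift _ (c ·s (1s *s qpow e)) (·s-*s c 1s (qpow e))) (lift _ (c ·s qpow e) (λ n → P.cong (c ℤ.*_) (*s-identityˡ (qpow e) n))))

  opaque
    Po : ℤ → ℕ → ℕ → ℕ → S
    Po c e s n = ⟨ poch c e s n ⟩

  -- the coefficient c = -1, so that (-q^e;q^s)_n = Po m1 e s n
  m1 : ℤ
  m1 = ℤ.- (+ 1)

  fac-cong : ∀ c {a b} → a ≡ b → fac c a ≈ fac c b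
  fac-cong c P.refl = ≈refl

  opaque
    unfolding Po
    Po-0 : ∀ c e s → Po c e s 0 ≈ 1#
    Po-0 c e s = 𝟙-def

  opaque
    unfolding Po
    Po-suc : ∀ c e s n → Po c e s (suc n) ≈ fac c e * Po c (e ℕ.+ s) s n
    Po-suc c e s n = begin
      Po c e s (suc n) ≈⟨ ≈sym (⊗-def (g 0) _) ⟩
      ⟨ g 0 ⟩ * ⟨ prodS (map g (applyUpTo suc n)) ⟩
        ≈⟨ *-cong (≈trans (fac-def c (e ℕ.+ s ℕ.* 0)) (fac-cong c (P.trans (P.cong (e ℕ.+_) (NP.*-zeroʳ s)) (NP.+-identityʳ e)))) (≈≡ (P.cong (λ l → ⟨ prodS l ⟩) (P.trans (LP.map-applyUpTo suc g n) (P.sym (LP.map-upTo (g ∘ suc) n))))) ⟩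
      fac c e * ⟨ prodS (map (g ∘ suc) (upTo n)) ⟩
        ≈⟨ *-cong ≈refl (prodS-map-cong (upTo n) (λ k → ≈≡ (P.cong (λ z → ⟨ 1s +s (ℤ.- c) ·s qpow z ⟩) (arith k)))) ⟩
      fac c e * Po c (e ℕ.+ s) s n ∎
      where
      open SetoidR setoid
      g : ℕ → Series
      g k = 1s +s (ℤ.- c) ·s qpow (e ℕ.+ s ℕ.* k)
      arith : ∀ k → e ℕ.+ s ℕ.* suc k ≡ e ℕ.+ s ℕ.+ s ℕ.* k
      arith k = P.trans (P.cong (e ℕ.+_) (NP.*-suc s k)) (P.sym (NP.+-assoc e s (s ℕ.* k)))

  opaque
    unfolding Po
    Po-cong : ∀ c e e' s n n' → e ≡ e' → n ≡ n' → Po c e s n ≈ Po c e' s n'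
    Po-cong c e e' s n n' P.refl P.refl = ≈refl

  Po-add : ∀ c e s a b → Po c e s (a ℕ.+ b) ≈ Po c e s a * Po c (e ℕ.+ s ℕ.* a) s b
  Po-add c e s zero b = ≈trans (Po-cong c e (e ℕ.+ s ℕ.* 0) s b b (P.sym (P.trans (P.cong (e ℕ.+_) (NP.*-zeroʳ s)) (NP.+-identityʳ e))) P.refl) (≈trans (≈sym (*-identityˡ (Po c (e ℕ.+ s ℕ.* 0) s b))) (*-cong (≈sym (Po-0 c e s)) ≈refl))
  Po-add c e s (suc a) b = begin
    Po c e s (suc (a ℕ.+ b)) ≈⟨ Po-suc c e s (a ℕ.+ b) ⟩
    fac c e * Po c (e ℕ.+ s) s (a ℕ.+ b) ≈⟨ *-cong ≈refl (Po-add c (e ℕ.+ s) s a b) ⟩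
    fac c e * (Po c (e ℕ.+ s) s a * Po c (e ℕ.+ s ℕ.+ s ℕ.* a) s b) ≈⟨ ≈sym (*-assoc _ _ _) ⟩
    fac c e * Po c (e ℕ.+ s) s a * Po c (e ℕ.+ s ℕ.+ s ℕ.* a) s b ≈⟨ *-cong (≈sym (Po-suc c e s a)) (Po-cong c _ _ s b b arith P.refl) ⟩
    Po c e s (suc a) * Po c (e ℕ.+ s ℕ.* suc a) s b ∎
    where
    open SetoidR setoid
    arith : e ℕ.+ s ℕ.+ s ℕ.* a ≡ e ℕ.+ s ℕ.* suc a
    arith = P.trans (NP.+-assoc e s (s ℕ.* a)) (P.cong (e ℕ.+_) (P.sym (NP.*-suc s a)))

  Po-snoc : ∀ c e s n → Po c e s (suc n) ≈ Po c e s n * fac c (e ℕ.+ s ℕ.* n)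
  Po-snoc c e s n = begin
    Po c e s (suc n) ≈⟨ Po-cong c e e s (suc n) (n ℕ.+ 1) P.refl (NP.+-comm 1 n) ⟩
    Po c e s (n ℕ.+ 1) ≈⟨ Po-add c e s n 1 ⟩
    Po c e s n * Po c (e ℕ.+ s ℕ.* n) s 1 ≈⟨ *-cong ≈refl (≈trans (Po-suc c _ s 0) (≈trans (*-cong ≈refl (Po-0 c (e ℕ.+ s ℕ.* n ℕ.+ s) s)) (*-identityʳ (fac c (e ℕ.+ s ℕ.* n))))) ⟩
    Po c e s n * fac c (e ℕ.+ s ℕ.* n) ∎
    where open SetoidR setoid

  geom-shift : ∀ m n → m ≤ n → geom m n ≡ geom m (n ∸ m)
  geom-shift m n m≤n with m ∣? n | m ∣? (n ∸ m)
  ... | yes _ | yes _ = P.refl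
  ... | no _ | no _ = P.refl
  ... | yes d | no nd = ⊥-elim (nd (ND.∣m+n∣m⇒∣n (P.subst (m ∣_) (P.sym (NP.m+[n∸m]≡n m≤n)) d) ND.∣-refl))
  ... | no nd | yes d = ⊥-elim (nd (ND.∣m∸n∣n⇒∣m m m≤n d ND.∣-refl))

  geom-low : ∀ m n → n < m → geom m n ≡ qpow 0 n
  geom-low m zero n<m with m ∣? 0
  ... | yes _ = P.refl
  ... | no nd = ⊥-elim (nd (m ND.∣0))
  geom-low m (suc n) n<m with m ∣? suc n
  ... | yes d = ⊥-elim (NP.<⇒≱ n<m (ND.∣⇒≤ d))
  ... | no _ = P.refl

  geom-inv : ∀ m → 0 < m → ((1s +s (ℤ.- (+ 1)) ·s qpow m) *s geom m) ≈s 1s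
  geom-inv m 0<m n = P.trans (*s-comm (1s +s h) g n) (P.trans (*s-distribˡ g 1s h n) (P.trans (P.cong₂ ℤ._+_ (P.trans (*s-comm g 1s n) (*s-identityˡ g n)) (P.trans (*s-comm g h n) (·s-*s (ℤ.- (+ 1)) (qpow m) g n))) (cases (m ℕ.≤? n))))
    where
    g = geom m
    h = (ℤ.- (+ 1)) ·s qpow m
    cases : Relation.Nullary.Dec (m ≤ n) → g n ℤ.+ (ℤ.- (+ 1)) ℤ.* (qpow m *s g) n ≡ 1s n
    cases (yes m≤n) = P.trans (P.cong₂ (λ a b → a ℤ.+ (ℤ.- (+ 1)) ℤ.* b) (geom-shift m n m≤n) (qpow-*-hi m g n m≤n))
      (P.trans (P.cong (λ z → g (n ∸ m) ℤ.+ z) (ZP.-1*i≡-i (g (n ∸ m)))) (P.trans (ZP.+-inverseʳ (g (n ∸ m))) (P.sym (qpow-≢ 0 n (λ e → NP.<⇒≱ 0<m (P.subst (m ≤_) (P.sym e) m≤n))))))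
    cases (no m≰n) = P.trans (P.cong (λ z → g n ℤ.+ (ℤ.- (+ 1)) ℤ.* z) (qpow-*-lo m g n (NP.≰⇒> m≰n))) (P.trans (ZP.+-identityʳ (g n)) (geom-low m n (NP.≰⇒> m≰n)))

  opaque
    F : ℕ → S
    F n = Po (+ 1) 6 6 n

  opaque
    R : ℕ → S
    R n = ⟨ recipQfac 6 n ⟩

  opaque
    unfolding R F Po
    FR : ∀ n → F n * R n ≈ 1#
    FR n = ≈trans (prodS-map-* (upTo n) fk (λ k → geom (6 ℕ.* suc k))) (≈trans (prodS-map-cong (upTo n) each) (prodS-ones (upTo n)))
      where
      fk : ℕ → Series
      fk k = 1s +s (ℤ.- (+ 1)) ·s qpow (6 ℕ.+ 6 ℕ.* k)
      each : ∀ k → ⟨ fk k *s geom (6 ℕ.* suc k) ⟩ ≈ ⟨ 1s ⟩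
      each k = mk≈ (λ i → P.trans (P.cong (λ z → ((1s +s (ℤ.- (+ 1)) ·s qpow z) *s geom (6 ℕ.* suc k)) i) (P.sym (NP.*-suc 6 k))) (geom-inv (6 ℕ.* suc k) (s≤s z≤n) i))

  RF : ∀ n → R n * F n ≈ 1#
  RF n = ≈trans (*-comm (R n) (F n)) (FR n)

  opaque
    unfolding F
    F-snoc : ∀ n → F (suc n) ≈ F n * fac (+ 1) (6 ℕ.+ 6 ℕ.* n)
    F-snoc n = Po-snoc (+ 1) 6 6 n

  R-step : ∀ n → R n ≈ fac (+ 1) (6 ℕ.+ 6 ℕ.* n) * R (suc n)
  R-step n = begin
    R n ≈⟨ ≈sym (*-identityʳ (R n)) ⟩
    R n * 1# ≈⟨ *-cong ≈refl (≈sym (FR (suc n))) ⟩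
    R n * (F (suc n) * R (suc n)) ≈⟨ *-cong ≈refl (*-cong (F-snoc n) ≈refl) ⟩
    R n * (F n * f * R (suc n)) ≈⟨ regroup (R n) (F n) f (R (suc n)) ⟩
    (F n * R n) * (f * R (suc n)) ≈⟨ *-cong (FR n) ≈refl ⟩
    1# * (f * R (suc n)) ≈⟨ *-identityˡ _ ⟩
    f * R (suc n) ∎
    where
    open SetoidR setoid
    f = fac (+ 1) (6 ℕ.+ 6 ℕ.* n)
    regroup : ∀ r a b r' → r * (a * b * r') ≈ (a * r) * (b * r')
    regroup = solve 4 (λ r a b r' → r :* (a :* b :* r') := (a :* r) :* (b :* r')) ≈refl

  opaque
    G : ℕ → ℕ → S
    G n k = ⟨ gaussBinom 6 (+ n) (+ k) ⟩

  opaque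
    unfolding G F R Po
    G-in : ∀ n k → k ≤ n → G n k ≈ F n * R k * R (n ∸ k)
    G-in n k k≤n with k ℕ.≤? n
    ... | yes _ = ≈trans (≈sym (⊗-def (qfac 6 n *s recipQfac 6 k) (recipQfac 6 (n ∸ k)))) (*-cong (≈sym (⊗-def (qfac 6 n) (recipQfac 6 k))) ≈refl)
    ... | no k≰n = ⊥-elim (k≰n k≤n)

  opaque
    unfolding G F R Po
    G-out : ∀ n k → n < k → G n k ≈ 0#
    G-out n k n<k with k ℕ.≤? n
    ... | yes k≤n = ⊥-elim (NP.<⇒≱ n<k k≤n)
    ... | no _ = 𝟘-def

  opaque
    unfolding R F Po
    R0 : R 0 ≈ 1#
    R0 = 𝟙-def

  G-diag : ∀ n → G n n ≈ 1#
  G-diag n = ≈trans (G-in n n NP.≤-refl) (≈trans (*-cong (FR n) (≈trans (≈≡ (P.cong R (NP.n∸n≡0 n))) R0)) (*-identityˡ 1#))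

  G-zero : ∀ n → G n 0 ≈ 1#
  G-zero n = ≈trans (G-in n 0 z≤n) (≈trans (*-cong (*-cong ≈refl R0) ≈refl) (≈trans (*-cong (*-identityʳ (F n)) ≈refl) (FR n)))

  -- Both q-Pascal rules for n = k + m + 1 start from the same expansion
  -- [n+1, k+1] = F(n+1) R(k+1) R(m+1) with F(n+1) = F n (1 - q^(6k+6) q^(6m+6)).
  module _ (k m : ℕ) where
    private
      n = suc (k ℕ.+ m)
      A = Q (6 ℕ.+ 6 ℕ.* k)
      B = Q (6 ℕ.+ 6 ℕ.* m)
      one = κ (+ 1)
      n∸k : n ∸ k ≡ suc m
      n∸k = P.trans (NP.+-∸-assoc 1 (NP.m≤m+n k m)) (P.cong suc (NP.m+n∸m≡n k m))
      open SetoidR setoid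

    pascal-expand : G (suc n) (suc k) ≈ F n * (one - one * (A * B)) * R (suc k) * R (suc m)
    pascal-expand = begin
      G (suc n) (suc k)
        ≈⟨ G-in (suc n) (suc k) (s≤s (NP.≤-trans (NP.m≤m+n k m) (NP.n≤1+n _))) ⟩
      F (suc n) * R (suc k) * R (suc n ∸ suc k)
        ≈⟨ *-cong (*-cong (F-snoc n) ≈refl) (≈≡ (P.cong R n∸k)) ⟩
      F n * fac (+ 1) (6 ℕ.+ 6 ℕ.* n) * R (suc k) * R (suc m)
        ≈⟨ *-cong (*-cong (*-cong ≈refl (+-cong ≈refl (-‿cong (*-cong ≈refl (≈sym AB))))) ≈refl) ≈refl ⟩
      F n * (one - one * (A * B)) * R (suc k) * R (suc m) ∎
      where
      AB : A * B ≈ Q (6 ℕ.+ 6 ℕ.* n)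
      AB = ≈trans (Q-+ _ _) (Q-cong (exponent k m))
        where
        exponent : ∀ k m → 6 ℕ.+ 6 ℕ.* k ℕ.+ (6 ℕ.+ 6 ℕ.* m) ≡ 6 ℕ.+ 6 ℕ.* suc (k ℕ.+ m)
        exponent = solve-∀

    pascal-left : G n k ≈ F n * ((one - one * A) * R (suc k)) * R (suc m)
    pascal-left = ≈trans (G-in n k (NP.≤-trans (NP.m≤m+n k m) (NP.n≤1+n _)))
                         (*-cong (*-cong ≈refl (R-step k)) (≈≡ (P.cong R n∸k)))

    pascal-right : G n (suc k) ≈ F n * R (suc k) * ((one - one * B) * R (suc m))
    pascal-right = ≈trans (G-in n (suc k) (s≤s (NP.m≤m+n k m)))
                          (*-cong ≈refl (≈trans (≈≡ (P.cong R (NP.m+n∸m≡n k m))) (R-step m)))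

    pascal-A-inner : G (suc n) (suc k) ≈ G n k + A * G n (suc k)
    pascal-A-inner = begin
      G (suc n) (suc k)                               ≈⟨ pascal-expand ⟩
      F n * (one - one * (A * B)) * R (suc k) * R (suc m)
        ≈⟨ split (F n) A B (R (suc k)) (R (suc m)) ⟩
      F n * ((one - one * A) * R (suc k)) * R (suc m) + A * (F n * R (suc k) * ((one - one * B) * R (suc m)))
        ≈⟨ ≈sym (+-cong pascal-left (*-cong ≈refl pascal-right)) ⟩
      G n k + A * G n (suc k)                         ∎
      where
      split : ∀ f a b x y → f * (one - one * (a * b)) * x * y ≈ f * ((one - one * a) * x) * y + a * (f * x * ((one - one * b) * y))
      split = solve 5 (λ f a b x y → f :* (con (+ 1) :- con (+ 1) :* (a :* b)) :* x :* y := f :* ((con (+ 1) :- con (+ 1) :* a) :* x) :* y :+ a :* (f :* x :* ((con (+ 1) :- con (+ 1) :* b) :* y))) ≈refl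

    pascal-B-inner : G (suc n) (suc k) ≈ G n (suc k) + B * G n k
    pascal-B-inner = begin
      G (suc n) (suc k)                               ≈⟨ pascal-expand ⟩
      F n * (one - one * (A * B)) * R (suc k) * R (suc m)
        ≈⟨ split (F n) A B (R (suc k)) (R (suc m)) ⟩
      F n * R (suc k) * ((one - one * B) * R (suc m)) + B * (F n * ((one - one * A) * R (suc k)) * R (suc m))
        ≈⟨ ≈sym (+-cong pascal-right (*-cong ≈refl pascal-left)) ⟩
      G n (suc k) + B * G n k                         ∎
      where
      split : ∀ f a b x y → f * (one - one * (a * b)) * x * y ≈ f * x * ((one - one * b) * y) + b * (f * ((one - one * a) * x) * y)
      split = solve 5 (λ f a b x y → f :* (con (+ 1) :- con (+ 1) :* (a :* b)) :* x :* y := f :* x :* ((con (+ 1) :- con (+ 1) :* b) :* y) :+ b :* (f :* ((con (+ 1) :- con (+ 1) :* a) :* x) :* y)) ≈refl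

  Pascal-A : ∀ n k → G (suc n) (suc k) ≈ G n k + Q (6 ℕ.+ 6 ℕ.* k) * G n (suc k)
  Pascal-A n k with NP.<-cmp k n
  ... | tri< k<n _ _ = P.subst (λ n → G (suc n) (suc k) ≈ G n k + Q (6 ℕ.+ 6 ℕ.* k) * G n (suc k)) eq core
    where
    m = n ∸ suc k
    eq : suc (k ℕ.+ m) ≡ n
    eq = NP.m+[n∸m]≡n k<n
    core : G (suc (suc (k ℕ.+ m))) (suc k) ≈ G (suc (k ℕ.+ m)) k + Q (6 ℕ.+ 6 ℕ.* k) * G (suc (k ℕ.+ m)) (suc k)
    core = pascal-A-inner k m
  ... | tri≈ _ P.refl _ = ≈trans (G-diag (suc n)) (≈sym (≈trans (+-cong (G-diag n) (*-cong ≈refl (G-out n (suc n) NP.≤-refl))) (≈trans (+-cong ≈refl (zeroʳ _)) (+-identityʳ 1#))))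
  ... | tri> _ _ n<k = ≈trans (G-out (suc n) (suc k) (s≤s n<k)) (≈sym (≈trans (+-cong (G-out n k n<k) (*-cong ≈refl (G-out n (suc k) (NP.m<n⇒m<1+n n<k)))) (≈trans (+-cong ≈refl (zeroʳ _)) (+-identityʳ 0#))))

  Pascal-B : ∀ n k → G (suc n) (suc k) ≈ G n (suc k) + Q (6 ℕ.* (n ∸ k)) * G n k
  Pascal-B n k with NP.<-cmp k n
  ... | tri< k<n _ _ = P.subst (λ n → G (suc n) (suc k) ≈ G n (suc k) + Q (6 ℕ.* (n ∸ k)) * G n k) eq core
    where
    m = n ∸ suc k
    eq : suc (k ℕ.+ m) ≡ n
    eq = NP.m+[n∸m]≡n k<n
    arith : 6 ℕ.+ 6 ℕ.* m ≡ 6 ℕ.* (suc (k ℕ.+ m) ∸ k)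
    arith = P.trans (P.sym (NP.*-suc 6 m)) (P.cong (6 ℕ.*_) (P.sym (P.trans (NP.+-∸-assoc 1 (NP.m≤m+n k m)) (P.cong suc (NP.m+n∸m≡n k m)))))
    core : G (suc (suc (k ℕ.+ m))) (suc k) ≈ G (suc (k ℕ.+ m)) (suc k) + Q (6 ℕ.* (suc (k ℕ.+ m) ∸ k)) * G (suc (k ℕ.+ m)) k
    core = ≈trans (pascal-B-inner k m) (+-cong ≈refl (*-cong (Q-cong arith) ≈refl))
  ... | tri≈ _ P.refl _ = ≈trans (G-diag (suc n)) (≈sym (≈trans (+-cong (G-out n (suc n) NP.≤-refl) (*-cong (≈trans (Q-cong (P.cong (6 ℕ.*_) (NP.n∸n≡0 n))) Q-0) (G-diag n))) (≈trans (+-identityˡ _) (*-identityˡ 1#))))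
  ... | tri> _ _ n<k = ≈trans (G-out (suc n) (suc k) (s≤s n<k)) (≈sym (≈trans (+-cong (G-out n (suc k) (NP.m<n⇒m<1+n n<k)) (*-cong ≈refl (G-out n k n<k))) (≈trans (+-cong ≈refl (zeroʳ _)) (+-identityʳ 0#))))

  opaque
    unfolding Po
    Po-def : ∀ c e s n → ⟨ poch c e s n ⟩ ≈ Po c e s n
    Po-def c e s n = ≈refl

  opaque
    unfolding G
    G-def : ∀ n k → ⟨ gaussBinom 6 (+ n) (+ k) ⟩ ≈ G n k
    G-def n k = ≈refl

  opaque
    unfolding R
    R-def : ∀ n → ⟨ recipQfac 6 n ⟩ ≈ R n
    R-def n = ≈refl

  opaque
    unfolding Q
    Q-def : ∀ n → ⟨ qpow n ⟩ ≈ Q n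
    Q-def n = ≈refl

  R2G : ∀ n k → k ≤ n → R n * G n k ≈ R k * R (n ∸ k)
  R2G n k k≤n = ≈trans (*-cong ≈refl (G-in n k k≤n)) (≈trans (regroup _ _ _ _) (≈trans (*-cong (RF n) ≈refl) (*-identityˡ _)))
    where
    regroup : ∀ r f a b → r * (f * a * b) ≈ (r * f) * (a * b)
    regroup = solve 4 (λ r f a b → r :* (f :* a :* b) := (r :* f) :* (a :* b)) ≈refl

module ChuVandermonde where

  open SeriesSums
  open SeriesRing
  open QFactorials
  open import Data.Nat as ℕ using (ℕ; zero; suc; _∸_; _≤_)
  import Data.Nat.Properties as NP
  open import Data.Integer using (+_)
  open import Relation.Binary.PropositionalEquality as P using (_≡_)
  import Relation.Binary.Reasoning.Setoid as SetoidR
  open import Data.Nat.Tactic.RingSolver using (solve-∀)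

  tri : ℕ → ℕ
  tri zero = 0
  tri (suc k) = k ℕ.+ tri k

  chuTerm : ℕ → ℕ → ℕ → ℕ → S
  chuTerm d m b k = Q (6 ℕ.* tri k ℕ.+ d ℕ.* k) * Po m1 b 6 k * Po (+ 1) (b ℕ.+ d ℕ.+ 6 ℕ.* k) 6 (m ∸ k)

  chuTerm-suc : ∀ d m b k → k ≤ m → chuTerm d (suc m) b k ≈ chuTerm d m b k * fac (+ 1) (b ℕ.+ d ℕ.+ 6 ℕ.* m)
  chuTerm-suc d m b k k≤m = begin
    Q (6 ℕ.* tri k ℕ.+ d ℕ.* k) * Po m1 b 6 k * Po (+ 1) E 6 (suc m ∸ k)
      ≈⟨ *-cong ≈refl (≈trans (Po-cong (+ 1) E E 6 (suc m ∸ k) (suc (m ∸ k)) P.refl (NP.+-∸-assoc 1 k≤m)) (Po-snoc (+ 1) E 6 (m ∸ k))) ⟩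
    Q (6 ℕ.* tri k ℕ.+ d ℕ.* k) * Po m1 b 6 k * (Po (+ 1) E 6 (m ∸ k) * fac (+ 1) (E ℕ.+ 6 ℕ.* (m ∸ k)))
      ≈⟨ *-cong ≈refl (*-cong ≈refl (fac-cong (+ 1) last)) ⟩
    Q (6 ℕ.* tri k ℕ.+ d ℕ.* k) * Po m1 b 6 k * (Po (+ 1) E 6 (m ∸ k) * fac (+ 1) (b ℕ.+ d ℕ.+ 6 ℕ.* m))
      ≈⟨ ≈sym (*-assoc _ _ _) ⟩
    chuTerm d m b k * fac (+ 1) (b ℕ.+ d ℕ.+ 6 ℕ.* m) ∎
    where
    open SetoidR setoid
    E = b ℕ.+ d ℕ.+ 6 ℕ.* k
    regroup : ∀ b d k j → b ℕ.+ d ℕ.+ 6 ℕ.* k ℕ.+ 6 ℕ.* j ≡ b ℕ.+ d ℕ.+ 6 ℕ.* (k ℕ.+ j)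
    regroup = solve-∀
    last : E ℕ.+ 6 ℕ.* (m ∸ k) ≡ b ℕ.+ d ℕ.+ 6 ℕ.* m
    last = P.trans (regroup b d k (m ∸ k)) (P.cong (λ z → b ℕ.+ d ℕ.+ 6 ℕ.* z) (NP.m+[n∸m]≡n k≤m))

  chuTerm-shift : ∀ d m b k → k ≤ m →
    Q (6 ℕ.* (m ∸ k)) * G m k * chuTerm d (suc m) b (suc k)
      ≈ (Q (6 ℕ.* m ℕ.+ d) * fac m1 b) * (G m k * chuTerm d m (b ℕ.+ 6) k)
  chuTerm-shift d m b k k≤m = begin
    A * g * (Bq * Po m1 b 6 (suc k) * Po (+ 1) (b ℕ.+ d ℕ.+ 6 ℕ.* suc k) 6 (m ∸ k))
      ≈⟨ *-cong ≈refl (*-cong (*-cong ≈refl (Po-suc m1 b 6 k)) (Po-cong (+ 1) _ (b ℕ.+ 6 ℕ.+ d ℕ.+ 6 ℕ.* k) 6 (m ∸ k) (m ∸ k) (shiftE b d k) P.refl)) ⟩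
    A * g * (Bq * (fb * P1) * P2)         ≈⟨ regroup₁ A g Bq fb P1 P2 ⟩
    (A * Bq) * (fb * (g * (P1 * P2)))     ≈⟨ *-cong AB ≈refl ⟩
    (C * Qb) * (fb * (g * (P1 * P2)))     ≈⟨ regroup₂ C Qb fb g P1 P2 ⟩
    (C * fb) * (g * (Qb * P1 * P2))       ∎
    where
    open SetoidR setoid
    A = Q (6 ℕ.* (m ∸ k))
    g = G m k
    Bq = Q (6 ℕ.* tri (suc k) ℕ.+ d ℕ.* suc k)
    Qb = Q (6 ℕ.* tri k ℕ.+ d ℕ.* k)
    C = Q (6 ℕ.* m ℕ.+ d)
    fb = fac m1 b
    P1 = Po m1 (b ℕ.+ 6) 6 k
    P2 = Po (+ 1) (b ℕ.+ 6 ℕ.+ d ℕ.+ 6 ℕ.* k) 6 (m ∸ k)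
    shiftE : ∀ b d k → b ℕ.+ d ℕ.+ 6 ℕ.* suc k ≡ b ℕ.+ 6 ℕ.+ d ℕ.+ 6 ℕ.* k
    shiftE = solve-∀
    exponent : ∀ j k t d → 6 ℕ.* j ℕ.+ (6 ℕ.* (k ℕ.+ t) ℕ.+ d ℕ.* suc k) ≡ 6 ℕ.* (k ℕ.+ j) ℕ.+ d ℕ.+ (6 ℕ.* t ℕ.+ d ℕ.* k)
    exponent = solve-∀
    AB : A * Bq ≈ C * Qb
    AB = ≈trans (Q-+ _ _) (≈trans (Q-cong (P.trans (exponent (m ∸ k) k (tri k) d) (P.cong (λ z → 6 ℕ.* z ℕ.+ d ℕ.+ (6 ℕ.* tri k ℕ.+ d ℕ.* k)) (NP.m+[n∸m]≡n k≤m)))) (≈sym (Q-+ _ _)))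
    regroup₁ : ∀ a g b f p1 p2 → a * g * (b * (f * p1) * p2) ≈ (a * b) * (f * (g * (p1 * p2)))
    regroup₁ = solve 6 (λ a g b f p1 p2 → a :* g :* (b :* (f :* p1) :* p2) := (a :* b) :* (f :* (g :* (p1 :* p2)))) ≈refl
    regroup₂ : ∀ c qb f g p1 p2 → (c * qb) * (f * (g * (p1 * p2))) ≈ (c * f) * (g * (qb * p1 * p2))
    regroup₂ = solve 6 (λ c qb f g p1 p2 → (c :* qb) :* (f :* (g :* (p1 :* p2))) := (c :* f) :* (g :* (qb :* p1 :* p2))) ≈refl

  chu-combine : ∀ d m b (P : S) →
    P * fac (+ 1) (b ℕ.+ d ℕ.+ 6 ℕ.* m) + (Q (6 ℕ.* m ℕ.+ d) * fac m1 b) * P ≈ P * fac m1 (d ℕ.+ 6 ℕ.* m)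
  chu-combine d m b P = begin
    P * (κ (+ 1) - κ (+ 1) * Q (b ℕ.+ d ℕ.+ 6 ℕ.* m)) + (C * fb) * P
      ≈⟨ +-cong (*-cong ≈refl (+-cong ≈refl (-‿cong (*-cong ≈refl Cb)))) ≈refl ⟩
    P * (κ (+ 1) - κ (+ 1) * (C * Q b)) + (C * (κ (+ 1) - κ m1 * Q b)) * P
      ≈⟨ cancel P C (Q b) ⟩
    P * (κ (+ 1) - κ m1 * C)
      ≈⟨ *-cong ≈refl (+-cong ≈refl (-‿cong (*-cong ≈refl (Q-cong (NP.+-comm (6 ℕ.* m) d))))) ⟩
    P * fac m1 (d ℕ.+ 6 ℕ.* m) ∎
    where
    open SetoidR setoid
    C = Q (6 ℕ.* m ℕ.+ d)
    fb = fac m1 b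
    exponent : ∀ b d m → 6 ℕ.* m ℕ.+ d ℕ.+ b ≡ b ℕ.+ d ℕ.+ 6 ℕ.* m
    exponent = solve-∀
    Cb : Q (b ℕ.+ d ℕ.+ 6 ℕ.* m) ≈ C * Q b
    Cb = ≈sym (≈trans (Q-+ _ _) (Q-cong (exponent b d m)))
    cancel : ∀ p c x → p * (κ (+ 1) - κ (+ 1) * (c * x)) + (c * (κ (+ 1) - κ m1 * x)) * p ≈ p * (κ (+ 1) - κ m1 * c)
    cancel = solve 3 (λ p c x → p :* (con (+ 1) :- con (+ 1) :* (c :* x)) :+ (c :* (con (+ 1) :- con m1 :* x)) :* p := p :* (con (+ 1) :- con m1 :* c)) ≈refl

  chu-unshifted : ∀ d m b → ΣS (suc m) (λ k → G m k * chuTerm d m b k) ≈ Po m1 d 6 m →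
    G (suc m) 0 * chuTerm d (suc m) b 0 + ΣS (suc m) (λ k → G m (suc k) * chuTerm d (suc m) b (suc k))
      ≈ Po m1 d 6 m * fac (+ 1) (b ℕ.+ d ℕ.+ 6 ℕ.* m)
  chu-unshifted d m b induction = begin
    G (suc m) 0 * T 0 + ΣS (suc m) (λ k → G m (suc k) * T (suc k))
      ≈⟨ +-cong (*-cong (≈trans (G-zero (suc m)) (≈sym (G-zero m))) ≈refl) ≈refl ⟩
    G m 0 * T 0 + ΣS (suc m) (λ k → G m (suc k) * T (suc k))
      ≈⟨ ≈sym (ΣS-suc (suc m) (λ k → G m k * T k)) ⟩
    ΣS (suc (suc m)) (λ k → G m k * T k)
      ≈⟨ ΣS-snoc (suc m) (λ k → G m k * T k) ⟩
    ΣS (suc m) (λ k → G m k * T k) + G m (suc m) * T (suc m)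
      ≈⟨ ≈trans (+-cong ≈refl (≈trans (*-cong (G-out m (suc m) NP.≤-refl) ≈refl) (zeroˡ _))) (+-identityʳ _) ⟩
    ΣS (suc m) (λ k → G m k * T k)
      ≈⟨ ΣS-cong (suc m) (λ k k<sm → ≈trans (*-cong ≈refl (chuTerm-suc d m b k (NP.<⇒≤pred k<sm))) (≈sym (*-assoc _ _ _))) ⟩
    ΣS (suc m) (λ k → G m k * chuTerm d m b k * fac (+ 1) (b ℕ.+ d ℕ.+ 6 ℕ.* m))
      ≈⟨ ≈sym (ΣS-*ʳ (suc m) (λ k → G m k * chuTerm d m b k) _) ⟩
    ΣS (suc m) (λ k → G m k * chuTerm d m b k) * fac (+ 1) (b ℕ.+ d ℕ.+ 6 ℕ.* m)
      ≈⟨ *-cong induction ≈refl ⟩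
    Po m1 d 6 m * fac (+ 1) (b ℕ.+ d ℕ.+ 6 ℕ.* m) ∎
    where
    open SetoidR setoid
    T = chuTerm d (suc m) b

  chu-shifted : ∀ d m b → ΣS (suc m) (λ k → G m k * chuTerm d m (b ℕ.+ 6) k) ≈ Po m1 d 6 m →
    ΣS (suc m) (λ k → Q (6 ℕ.* (m ∸ k)) * G m k * chuTerm d (suc m) b (suc k)) ≈ (Q (6 ℕ.* m ℕ.+ d) * fac m1 b) * Po m1 d 6 m
  chu-shifted d m b induction = begin
    ΣS (suc m) (λ k → Q (6 ℕ.* (m ∸ k)) * G m k * chuTerm d (suc m) b (suc k))
      ≈⟨ ΣS-cong (suc m) (λ k k<sm → chuTerm-shift d m b k (NP.<⇒≤pred k<sm)) ⟩
    ΣS (suc m) (λ k → (Q (6 ℕ.* m ℕ.+ d) * fac m1 b) * (G m k * chuTerm d m (b ℕ.+ 6) k))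
      ≈⟨ ≈sym (ΣS-*ˡ (suc m) (λ k → G m k * chuTerm d m (b ℕ.+ 6) k) _) ⟩
    (Q (6 ℕ.* m ℕ.+ d) * fac m1 b) * ΣS (suc m) (λ k → G m k * chuTerm d m (b ℕ.+ 6) k)
      ≈⟨ *-cong ≈refl induction ⟩
    (Q (6 ℕ.* m ℕ.+ d) * fac m1 b) * Po m1 d 6 m ∎
    where open SetoidR setoid

  -- q-Chu-Vandermonde in the form
  --   Σ_{k=0}^{m} [m, k] q^(6 tri k + d k) (-q^b;q^6)_k (q^(b+d+6k);q^6)_(m-k) = (-q^d;q^6)_m,
  -- by induction on m, splitting [m+1, k] with the second q-Pascal rule
  q-Chu-Vandermonde : ∀ d m b → ΣS (suc m) (λ k → G m k * chuTerm d m b k) ≈ Po m1 d 6 m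
  q-Chu-Vandermonde d zero b = begin
    ΣS 1 (λ k → G 0 k * chuTerm d 0 b k)
      ≈⟨ ≈trans (ΣS-suc 0 (λ k → G 0 k * chuTerm d 0 b k)) (≈trans (+-cong ≈refl (ΣS-0 _)) (+-identityʳ _)) ⟩
    G 0 0 * chuTerm d 0 b 0
      ≈⟨ *-cong (G-zero 0) (*-cong (*-cong (≈trans (Q-cong (noExponent d)) Q-0) (Po-0 m1 b 6)) (Po-0 (+ 1) _ 6)) ⟩
    1# * (1# * 1# * 1#)   ≈⟨ ≈trans (*-identityˡ _) (≈trans (*-identityʳ _) (*-identityʳ _)) ⟩
    1#                    ≈⟨ ≈sym (Po-0 m1 d 6) ⟩
    Po m1 d 6 0           ∎
    where
    open SetoidR setoid
    noExponent : ∀ d → 6 ℕ.* 0 ℕ.+ d ℕ.* 0 ≡ 0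
    noExponent = solve-∀
  q-Chu-Vandermonde d (suc m) b = begin
    ΣS (suc (suc m)) (λ k → G (suc m) k * T k)
      ≈⟨ ΣS-suc (suc m) (λ k → G (suc m) k * T k) ⟩
    G (suc m) 0 * T 0 + ΣS (suc m) (λ k → G (suc m) (suc k) * T (suc k))
      ≈⟨ +-cong ≈refl (≈trans (ΣS-cong' (suc m) (λ k → ≈trans (*-cong (Pascal-B m k) ≈refl) (distribʳ _ _ _)))
                              (ΣS-+ (suc m) (λ k → G m (suc k) * T (suc k)) (λ k → Q (6 ℕ.* (m ∸ k)) * G m k * T (suc k)))) ⟩
    G (suc m) 0 * T 0 + (ΣS (suc m) (λ k → G m (suc k) * T (suc k)) + ΣS (suc m) (λ k → Q (6 ℕ.* (m ∸ k)) * G m k * T (suc k)))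
      ≈⟨ ≈sym (+-assoc _ _ _) ⟩
    G (suc m) 0 * T 0 + ΣS (suc m) (λ k → G m (suc k) * T (suc k)) + ΣS (suc m) (λ k → Q (6 ℕ.* (m ∸ k)) * G m k * T (suc k))
      ≈⟨ +-cong (chu-unshifted d m b (q-Chu-Vandermonde d m b)) (chu-shifted d m b (q-Chu-Vandermonde d m (b ℕ.+ 6))) ⟩
    Po m1 d 6 m * fac (+ 1) (b ℕ.+ d ℕ.+ 6 ℕ.* m) + (Q (6 ℕ.* m ℕ.+ d) * fac m1 b) * Po m1 d 6 m
      ≈⟨ chu-combine d m b (Po m1 d 6 m) ⟩
    Po m1 d 6 m * fac m1 (d ℕ.+ 6 ℕ.* m)
      ≈⟨ ≈sym (Po-snoc m1 d 6 m) ⟩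
    Po m1 d 6 (suc m) ∎
    where
    open SetoidR setoid
    T = chuTerm d (suc m) b

module BaileyKernel where

  open SeriesRing
  open SeriesSums
  open QFactorials
  open ChuVandermonde
  open import Data.Nat as ℕ using (ℕ; zero; suc; _∸_; _≤_)
  import Data.Nat.Properties as NP
  open import Data.Integer using (+_)
  open import Relation.Binary.PropositionalEquality as P using (_≡_)
  import Relation.Binary.Reasoning.Setoid as SetoidR
  open import Data.Nat.Tactic.RingSolver using (solve-∀)

  opaque
    unfolding F
    F-add : ∀ a c → F (a ℕ.+ c) ≈ F a * Po (+ 1) (6 ℕ.+ 6 ℕ.* a) 6 c
    F-add a c = Po-add (+ 1) 6 6 a c

  PR : ∀ a c → Po (+ 1) (6 ℕ.+ 6 ℕ.* a) 6 c * R (a ℕ.+ c) ≈ R a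
  PR a c = begin
    Pc * R (a ℕ.+ c)                      ≈⟨ ≈sym (*-identityˡ _) ⟩
    1# * (Pc * R (a ℕ.+ c))               ≈⟨ *-cong (≈sym (RF a)) ≈refl ⟩
    (R a * F a) * (Pc * R (a ℕ.+ c))      ≈⟨ regroup (R a) (F a) Pc (R (a ℕ.+ c)) ⟩
    R a * ((F a * Pc) * R (a ℕ.+ c))      ≈⟨ *-cong ≈refl (*-cong (≈sym (F-add a c)) ≈refl) ⟩
    R a * (F (a ℕ.+ c) * R (a ℕ.+ c))     ≈⟨ *-cong ≈refl (FR (a ℕ.+ c)) ⟩
    R a * 1#                              ≈⟨ *-identityʳ _ ⟩
    R a                                   ∎
    where
    open SetoidR setoid
    Pc = Po (+ 1) (6 ℕ.+ 6 ℕ.* a) 6 c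
    regroup : ∀ r f p s → (r * f) * (p * s) ≈ r * ((f * p) * s)
    regroup = solve 4 (λ r f p s → (r :* f) :* (p :* s) := r :* ((f :* p) :* s)) ≈refl

  tri2 : ∀ k → 2 ℕ.* tri k ℕ.+ k ≡ k ℕ.* k
  tri2 zero = P.refl
  tri2 (suc k) = P.trans (expand k (tri k)) (P.trans (P.cong (λ z → z ℕ.+ suc (k ℕ.+ k)) (tri2 k)) (square k))
    where
    expand : ∀ k t → 2 ℕ.* (k ℕ.+ t) ℕ.+ suc k ≡ 2 ℕ.* t ℕ.+ k ℕ.+ suc (k ℕ.+ k)
    expand = solve-∀
    square : ∀ k → k ℕ.* k ℕ.+ suc (k ℕ.+ k) ≡ suc k ℕ.* suc k
    square = solve-∀

  kernelTerm : ℕ → ℕ → ℕ → S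
  kernelTerm j m k = Q (3 ℕ.* ((j ℕ.+ k) ℕ.* (j ℕ.+ k))) * Po m1 3 6 (j ℕ.+ k) * R k * R (m ∸ k) * R (2 ℕ.* j ℕ.+ k)

  kernelValue : ℕ → ℕ → S
  kernelValue j m = Q (3 ℕ.* (j ℕ.* j)) * Po m1 3 6 j * R m * R (2 ℕ.* j ℕ.+ m)

  -- each kernel summand is a q-Chu-Vandermonde summand with d = b = 6j + 3
  kernelTerm-chu : ∀ j m k → k ≤ m → G m k * chuTerm (3 ℕ.+ 6 ℕ.* j) m (3 ℕ.+ 6 ℕ.* j) k * kernelValue j m ≈ kernelTerm j m k
  kernelTerm-chu j m k k≤m = begin
    G m k * (Qx * Pa * Pb) * (Qj * Pj * R m * R (2 ℕ.* j ℕ.+ m))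
      ≈⟨ *-cong (*-cong (G-in m k k≤m) ≈refl) ≈refl ⟩
    F m * R k * R (m ∸ k) * (Qx * Pa * Pb) * (Qj * Pj * R m * R (2 ℕ.* j ℕ.+ m))
      ≈⟨ regroup (F m) (R k) (R (m ∸ k)) Qx Pa Pb Qj Pj (R m) (R (2 ℕ.* j ℕ.+ m)) ⟩
    (F m * R m) * (Qj * Qx) * (Pj * Pa) * R k * R (m ∸ k) * (Pb * R (2 ℕ.* j ℕ.+ m))
      ≈⟨ *-cong (*-cong (*-cong (*-cong (*-cong (FR m) powers) (≈sym (Po-add m1 3 6 j k))) ≈refl) ≈refl) quotient ⟩
    1# * Q (3 ℕ.* ((j ℕ.+ k) ℕ.* (j ℕ.+ k))) * Po m1 3 6 (j ℕ.+ k) * R k * R (m ∸ k) * R (2 ℕ.* j ℕ.+ k)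
      ≈⟨ *-cong (*-cong (*-cong (*-cong (*-identityˡ _) ≈refl) ≈refl) ≈refl) ≈refl ⟩
    kernelTerm j m k ∎
    where
    open SetoidR setoid
    d = 3 ℕ.+ 6 ℕ.* j
    Qx = Q (6 ℕ.* tri k ℕ.+ d ℕ.* k)
    Pa = Po m1 d 6 k
    Pb = Po (+ 1) (d ℕ.+ d ℕ.+ 6 ℕ.* k) 6 (m ∸ k)
    Qj = Q (3 ℕ.* (j ℕ.* j))
    Pj = Po m1 3 6 j
    regroup : ∀ f rk rd qx pa pb qj pj rm r2 → f * rk * rd * (qx * pa * pb) * (qj * pj * rm * r2) ≈ (f * rm) * (qj * qx) * (pj * pa) * rk * rd * (pb * r2)
    regroup = solve 10 (λ f rk rd qx pa pb qj pj rm r2 → f :* rk :* rd :* (qx :* pa :* pb) :* (qj :* pj :* rm :* r2) := (f :* rm) :* (qj :* qx) :* (pj :* pa) :* rk :* rd :* (pb :* r2)) ≈refl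
    exponent : ∀ j k t → 2 ℕ.* t ℕ.+ k ≡ k ℕ.* k → 3 ℕ.* (j ℕ.* j) ℕ.+ (6 ℕ.* t ℕ.+ (3 ℕ.+ 6 ℕ.* j) ℕ.* k) ≡ 3 ℕ.* ((j ℕ.+ k) ℕ.* (j ℕ.+ k))
    exponent j k t h = P.trans (collect j k t) (P.trans (P.cong (λ z → 3 ℕ.* (j ℕ.* j) ℕ.+ 3 ℕ.* z ℕ.+ 6 ℕ.* (j ℕ.* k)) h) (square j k))
      where
      collect : ∀ j k t → 3 ℕ.* (j ℕ.* j) ℕ.+ (6 ℕ.* t ℕ.+ (3 ℕ.+ 6 ℕ.* j) ℕ.* k) ≡ 3 ℕ.* (j ℕ.* j) ℕ.+ 3 ℕ.* (2 ℕ.* t ℕ.+ k) ℕ.+ 6 ℕ.* (j ℕ.* k)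
      collect = solve-∀
      square : ∀ j k → 3 ℕ.* (j ℕ.* j) ℕ.+ 3 ℕ.* (k ℕ.* k) ℕ.+ 6 ℕ.* (j ℕ.* k) ≡ 3 ℕ.* ((j ℕ.+ k) ℕ.* (j ℕ.+ k))
      square = solve-∀
    powers : Qj * Qx ≈ Q (3 ℕ.* ((j ℕ.+ k) ℕ.* (j ℕ.+ k)))
    powers = ≈trans (Q-+ _ _) (Q-cong (exponent j k (tri k) (tri2 k)))
    base : ∀ j k → 3 ℕ.+ 6 ℕ.* j ℕ.+ (3 ℕ.+ 6 ℕ.* j) ℕ.+ 6 ℕ.* k ≡ 6 ℕ.+ 6 ℕ.* (2 ℕ.* j ℕ.+ k)
    base = solve-∀
    length : 2 ℕ.* j ℕ.+ k ℕ.+ (m ∸ k) ≡ 2 ℕ.* j ℕ.+ m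
    length = P.trans (NP.+-assoc (2 ℕ.* j) k (m ∸ k)) (P.cong (2 ℕ.* j ℕ.+_) (NP.m+[n∸m]≡n k≤m))
    quotient : Pb * R (2 ℕ.* j ℕ.+ m) ≈ R (2 ℕ.* j ℕ.+ k)
    quotient = ≈trans (*-cong (Po-cong (+ 1) _ _ 6 (m ∸ k) (m ∸ k) (base j k) P.refl) (≈≡ (P.cong R (P.sym length)))) (PR (2 ℕ.* j ℕ.+ k) (m ∸ k))

  bailey-kernel : ∀ j m → ΣS (suc m) (kernelTerm j m) ≈ Po m1 3 6 (j ℕ.+ m) * Q (3 ℕ.* (j ℕ.* j)) * R m * R (2 ℕ.* j ℕ.+ m)
  bailey-kernel j m = begin
    ΣS (suc m) (kernelTerm j m)
      ≈⟨ ≈sym (ΣS-cong (suc m) (λ k k<sm → kernelTerm-chu j m k (NP.<⇒≤pred k<sm))) ⟩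
    ΣS (suc m) (λ k → G m k * chuTerm d m d k * kernelValue j m)
      ≈⟨ ≈sym (ΣS-*ʳ (suc m) (λ k → G m k * chuTerm d m d k) (kernelValue j m)) ⟩
    ΣS (suc m) (λ k → G m k * chuTerm d m d k) * kernelValue j m
      ≈⟨ *-cong (q-Chu-Vandermonde d m d) ≈refl ⟩
    Po m1 d 6 m * (Q (3 ℕ.* (j ℕ.* j)) * Po m1 3 6 j * R m * R (2 ℕ.* j ℕ.+ m))
      ≈⟨ regroup (Po m1 d 6 m) (Q (3 ℕ.* (j ℕ.* j))) (Po m1 3 6 j) (R m) (R (2 ℕ.* j ℕ.+ m)) ⟩
    Po m1 3 6 j * Po m1 d 6 m * Q (3 ℕ.* (j ℕ.* j)) * R m * R (2 ℕ.* j ℕ.+ m)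
      ≈⟨ *-cong (*-cong (*-cong (≈sym (Po-add m1 3 6 j m)) ≈refl) ≈refl) ≈refl ⟩
    Po m1 3 6 (j ℕ.+ m) * Q (3 ℕ.* (j ℕ.* j)) * R m * R (2 ℕ.* j ℕ.+ m) ∎
    where
    open SetoidR setoid
    d = 3 ℕ.+ 6 ℕ.* j
    regroup : ∀ p q a r s → p * (q * a * r * s) ≈ a * p * q * r * s
    regroup = solve 5 (λ p q a r s → p :* (q :* a :* r :* s) := a :* p :* q :* r :* s) ≈refl

module TripleProduct where

  open SeriesRing
  open SeriesSums
  open QFactorials
  open ChuVandermonde using (tri)
  open import Data.Nat as ℕ using (ℕ; zero; suc; _∸_; _≤_; _<_)
  import Data.Nat.Properties as NP
  open import Data.Integer using (+_)
  open import Relation.Binary.PropositionalEquality as P using (_≡_)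
  import Relation.Binary.Reasoning.Setoid as SetoidR
  open import Data.Nat.Tactic.RingSolver using (solve-∀)

  Q-+≡ : ∀ a b c → a ℕ.+ b ≡ c → Q a * Q b ≈ Q c
  Q-+≡ a b c e = ≈trans (Q-+ a b) (Q-cong e)

  G-cong : ∀ n n' k k' → n ≡ n' → k ≡ k' → G n k ≈ G n' k'
  G-cong n n' k k' P.refl P.refl = ≈refl

  swapQ : ∀ A g B C D → A * B ≈ C * D → A * g * B ≈ C * (g * D)
  swapQ A g B C D h = ≈trans (regroup₁ A g B) (≈trans (*-cong ≈refl h) (regroup₂ g C D))
    where
    regroup₁ : ∀ a g b → a * g * b ≈ g * (a * b)
    regroup₁ = solve 3 (λ a g b → a :* g :* b := g :* (a :* b)) ≈refl
    regroup₂ : ∀ g c d → g * (c * d) ≈ c * (g * d)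
    regroup₂ = solve 3 (λ g c d → g :* (c :* d) := c :* (g :* d)) ≈refl

  -- The finite triple-product sum  Σ_{j=-a}^{b} q^(3j²+2j) [a+b, a+j]_{q^6},
  -- split into the terms j = -i ≤ 0 (weight q^(3i²-2i) = q^(6 tri i + i))
  -- and j = i+1 > 0 (weight q^(3(i+1)²+2(i+1)) = q^(6 tri (i+1) + 5(i+1))).
  negWeight : ℕ → S
  negWeight i = Q (6 ℕ.* tri i ℕ.+ i)

  posWeight : ℕ → S
  posWeight i = Q (6 ℕ.* tri (suc i) ℕ.+ 5 ℕ.* suc i)

  negWeight-0 : negWeight 0 ≈ 1#
  negWeight-0 = Q-0

  negSum : ℕ → ℕ → S
  negSum n a = ΣS (suc a) (λ i → G n (a ∸ i) * negWeight i)

  negTail : ℕ → ℕ → S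
  negTail n a = ΣS a (λ i → G n (a ∸ suc i) * negWeight (suc i))

  negSum-split : ∀ n a → negSum n a ≈ G n a * negWeight 0 + negTail n a
  negSum-split n a = ΣS-suc a (λ i → G n (a ∸ i) * negWeight i)

  posSum : ℕ → ℕ → ℕ → S
  posSum n a b = ΣS b (λ i → G n (suc a ℕ.+ i) * posWeight i)

  -- Raising b (and n = a + b) by one: the second q-Pascal rule applied to
  -- every binomial, with the shifted parts recollected.
  negSum-sucB : ∀ n a b → n ≡ a ℕ.+ b → negSum (suc n) a ≈ negSum n a + Q (5 ℕ.+ 6 ℕ.* b) * negTail n a
  negSum-sucB n a b e = begin
    negSum (suc n) a ≈⟨ ΣS-snoc a (λ i → G (suc n) (a ∸ i) * negWeight i) ⟩
    ΣS a (λ i → G (suc n) (a ∸ i) * negWeight i) + G (suc n) (a ∸ a) * negWeight a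
      ≈⟨ +-cong (ΣS-cong a (λ i i<a → ≈trans (*-cong (≈trans (G-cong _ _ _ _ P.refl (index-suc i i<a)) (Pascal-B n (a ∸ suc i))) ≈refl) (distribʳ _ _ _)))
                (*-cong (≈trans (G-cong _ _ _ _ P.refl (NP.n∸n≡0 a)) (≈trans (G-zero (suc n)) (≈trans (≈sym (G-zero n)) (G-cong _ _ _ _ P.refl (P.sym (NP.n∸n≡0 a)))))) ≈refl) ⟩
    ΣS a (λ i → G n (suc (a ∸ suc i)) * negWeight i + Q (6 ℕ.* (n ∸ (a ∸ suc i))) * G n (a ∸ suc i) * negWeight i) + G n (a ∸ a) * negWeight a
      ≈⟨ +-cong (ΣS-+ a (λ i → G n (suc (a ∸ suc i)) * negWeight i) (λ i → Q (6 ℕ.* (n ∸ (a ∸ suc i))) * G n (a ∸ suc i) * negWeight i)) ≈refl ⟩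
    ΣS a (λ i → G n (suc (a ∸ suc i)) * negWeight i) + ΣS a (λ i → Q (6 ℕ.* (n ∸ (a ∸ suc i))) * G n (a ∸ suc i) * negWeight i) + G n (a ∸ a) * negWeight a
      ≈⟨ regroup₃ _ _ _ ⟩
    (ΣS a (λ i → G n (suc (a ∸ suc i)) * negWeight i) + G n (a ∸ a) * negWeight a) + ΣS a (λ i → Q (6 ℕ.* (n ∸ (a ∸ suc i))) * G n (a ∸ suc i) * negWeight i)
      ≈⟨ +-cong (+-cong (ΣS-cong a (λ i i<a → *-cong (G-cong _ _ _ _ P.refl (P.sym (index-suc i i<a))) ≈refl)) ≈refl) ≈refl ⟩
    (ΣS a (λ i → G n (a ∸ i) * negWeight i) + G n (a ∸ a) * negWeight a) + ΣS a (λ i → Q (6 ℕ.* (n ∸ (a ∸ suc i))) * G n (a ∸ suc i) * negWeight i)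
      ≈⟨ +-cong (≈sym (ΣS-snoc a (λ i → G n (a ∸ i) * negWeight i))) ≈refl ⟩
    negSum n a + ΣS a (λ i → Q (6 ℕ.* (n ∸ (a ∸ suc i))) * G n (a ∸ suc i) * negWeight i)
      ≈⟨ +-cong ≈refl (≈trans (ΣS-cong a (λ i i<a → swapQ _ _ _ _ _ (weight-shift i i<a))) (≈sym (ΣS-*ˡ a (λ i → G n (a ∸ suc i) * negWeight (suc i)) _))) ⟩
    negSum n a + Q (5 ℕ.+ 6 ℕ.* b) * negTail n a ∎
    where
    open SetoidR setoid
    index-suc : ∀ i → i < a → a ∸ i ≡ suc (a ∸ suc i)
    index-suc i i<a = NP.+-∸-assoc 1 i<a
    regroup₃ : ∀ x y z → x + y + z ≈ (x + z) + y
    regroup₃ = solve 3 (λ x y z → x :+ y :+ z := (x :+ z) :+ y) ≈refl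
    weight-shift : ∀ i → i < a → Q (6 ℕ.* (n ∸ (a ∸ suc i))) * negWeight i ≈ Q (5 ℕ.+ 6 ℕ.* b) * negWeight (suc i)
    weight-shift i i<a = ≈trans (Q-+ _ _) (≈trans (Q-cong arith) (≈sym (Q-+ _ _)))
      where
      d = a ∸ suc i
      ad : a ≡ suc i ℕ.+ d
      ad = P.sym (NP.m+[n∸m]≡n i<a)
      nd : n ∸ d ≡ b ℕ.+ suc i
      nd = P.trans (P.cong (_∸ d) (P.trans e (P.cong (ℕ._+ b) ad))) (P.trans (P.cong (_∸ d) (arith₀ i d b)) (NP.m+n∸n≡m (b ℕ.+ suc i) d))
        where
        arith₀ : ∀ i d b → suc i ℕ.+ d ℕ.+ b ≡ b ℕ.+ suc i ℕ.+ d
        arith₀ = solve-∀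
      arith′ : ∀ b i t → 6 ℕ.* (b ℕ.+ suc i) ℕ.+ (6 ℕ.* t ℕ.+ i) ≡ 5 ℕ.+ 6 ℕ.* b ℕ.+ (6 ℕ.* (i ℕ.+ t) ℕ.+ suc i)
      arith′ = solve-∀
      arith : 6 ℕ.* (n ∸ d) ℕ.+ (6 ℕ.* tri i ℕ.+ i) ≡ 5 ℕ.+ 6 ℕ.* b ℕ.+ (6 ℕ.* tri (suc i) ℕ.+ suc i)
      arith = P.trans (P.cong (λ z → 6 ℕ.* z ℕ.+ (6 ℕ.* tri i ℕ.+ i)) nd) (arith′ b i (tri i))

  posSum-sucB : ∀ n a b → n ≡ a ℕ.+ b → posSum (suc n) a (suc b) ≈ posSum n a b + Q (5 ℕ.+ 6 ℕ.* b) * (G n a * negWeight 0) + Q (5 ℕ.+ 6 ℕ.* b) * posSum n a b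
  posSum-sucB n a b e = begin
    posSum (suc n) a (suc b)
      ≈⟨ ≈trans (ΣS-cong' (suc b) (λ i → ≈trans (*-cong (Pascal-B n (a ℕ.+ i)) ≈refl) (distribʳ _ _ _))) (ΣS-+ (suc b) (λ i → G n (suc a ℕ.+ i) * posWeight i) (λ i → Q (6 ℕ.* (n ∸ (a ℕ.+ i))) * G n (a ℕ.+ i) * posWeight i)) ⟩
    ΣS (suc b) (λ i → G n (suc a ℕ.+ i) * posWeight i) + ΣS (suc b) (λ i → Q (6 ℕ.* (n ∸ (a ℕ.+ i))) * G n (a ℕ.+ i) * posWeight i)
      ≈⟨ +-cong (ΣS-snoc b (λ i → G n (suc a ℕ.+ i) * posWeight i)) (ΣS-suc b (λ i → Q (6 ℕ.* (n ∸ (a ℕ.+ i))) * G n (a ℕ.+ i) * posWeight i)) ⟩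
    (posSum n a b + G n (suc a ℕ.+ b) * posWeight b) + (Q (6 ℕ.* (n ∸ (a ℕ.+ 0))) * G n (a ℕ.+ 0) * posWeight 0 + ΣS b (λ i → Q (6 ℕ.* (n ∸ (a ℕ.+ suc i))) * G n (a ℕ.+ suc i) * posWeight (suc i)))
      ≈⟨ +-cong (≈trans (+-cong ≈refl (≈trans (*-cong (G-out n _ (P.subst (_< suc a ℕ.+ b) (P.sym e) NP.≤-refl)) ≈refl) (zeroˡ _))) (+-identityʳ _))
                (+-cong (≈trans (*-cong (*-cong ≈refl (G-cong _ _ _ _ P.refl (NP.+-identityʳ a))) ≈refl) (swapQ _ _ _ _ _ weight-shift₀))
                        (≈trans (ΣS-cong b (λ i i<b → ≈trans (*-cong (*-cong ≈refl (G-cong _ _ _ _ P.refl (NP.+-suc a i))) ≈refl) (swapQ _ _ _ _ _ (weight-shift i i<b))))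
                                (≈sym (ΣS-*ˡ b (λ i → G n (suc a ℕ.+ i) * posWeight i) _)))) ⟩
    posSum n a b + (Q (5 ℕ.+ 6 ℕ.* b) * (G n a * negWeight 0) + Q (5 ℕ.+ 6 ℕ.* b) * posSum n a b)
      ≈⟨ ≈sym (+-assoc _ _ _) ⟩
    posSum n a b + Q (5 ℕ.+ 6 ℕ.* b) * (G n a * negWeight 0) + Q (5 ℕ.+ 6 ℕ.* b) * posSum n a b ∎
    where
    open SetoidR setoid
    weight-shift₀ : Q (6 ℕ.* (n ∸ (a ℕ.+ 0))) * posWeight 0 ≈ Q (5 ℕ.+ 6 ℕ.* b) * negWeight 0
    weight-shift₀ = ≈trans (Q-+ _ _) (≈trans (Q-cong arith) (≈sym (Q-+ _ _)))
      where
      nb : n ∸ (a ℕ.+ 0) ≡ b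
      nb = P.trans (P.cong₂ _∸_ e (NP.+-identityʳ a)) (NP.m+n∸m≡n a b)
      arith′ : ∀ b → 6 ℕ.* b ℕ.+ (6 ℕ.* 0 ℕ.+ 5 ℕ.* 1) ≡ 5 ℕ.+ 6 ℕ.* b ℕ.+ (6 ℕ.* 0 ℕ.+ 0)
      arith′ = solve-∀
      arith : 6 ℕ.* (n ∸ (a ℕ.+ 0)) ℕ.+ (6 ℕ.* tri 1 ℕ.+ 5 ℕ.* 1) ≡ 5 ℕ.+ 6 ℕ.* b ℕ.+ (6 ℕ.* tri 0 ℕ.+ 0)
      arith = P.trans (P.cong (λ z → 6 ℕ.* z ℕ.+ (6 ℕ.* tri 1 ℕ.+ 5 ℕ.* 1)) nb) (arith′ b)
    weight-shift : ∀ i → i < b → Q (6 ℕ.* (n ∸ (a ℕ.+ suc i))) * posWeight (suc i) ≈ Q (5 ℕ.+ 6 ℕ.* b) * posWeight i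
    weight-shift i i<b = ≈trans (Q-+ _ _) (≈trans (Q-cong arith) (≈sym (Q-+ _ _)))
      where
      d = b ∸ suc i
      bd : b ≡ suc i ℕ.+ d
      bd = P.sym (NP.m+[n∸m]≡n i<b)
      nd : n ∸ (a ℕ.+ suc i) ≡ d
      nd = P.trans (P.cong (_∸ (a ℕ.+ suc i)) (P.trans e (P.trans (P.cong (a ℕ.+_) bd) (P.sym (NP.+-assoc a (suc i) d))))) (NP.m+n∸m≡n (a ℕ.+ suc i) d)
      arith′ : ∀ d i t → 6 ℕ.* d ℕ.+ (6 ℕ.* (suc i ℕ.+ (i ℕ.+ t)) ℕ.+ 5 ℕ.* suc (suc i)) ≡ 5 ℕ.+ 6 ℕ.* (suc i ℕ.+ d) ℕ.+ (6 ℕ.* (i ℕ.+ t) ℕ.+ 5 ℕ.* suc i)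
      arith′ = solve-∀
      arith : 6 ℕ.* (n ∸ (a ℕ.+ suc i)) ℕ.+ (6 ℕ.* tri (suc (suc i)) ℕ.+ 5 ℕ.* suc (suc i)) ≡ 5 ℕ.+ 6 ℕ.* b ℕ.+ (6 ℕ.* tri (suc i) ℕ.+ 5 ℕ.* suc i)
      arith = P.trans (P.cong (λ z → 6 ℕ.* z ℕ.+ (6 ℕ.* tri (suc (suc i)) ℕ.+ 5 ℕ.* suc (suc i))) nd) (P.trans (arith′ d i (tri i)) (P.cong (λ z → 5 ℕ.+ 6 ℕ.* z ℕ.+ (6 ℕ.* tri (suc i) ℕ.+ 5 ℕ.* suc i)) (P.sym bd)))

  -- Raising a (and n = a + b) by one: the first q-Pascal rule likewise.
  negSum-sucA : ∀ n a → negSum (suc n) (suc a) ≈ negSum n a + Q (6 ℕ.+ 6 ℕ.* a) * (G n (suc a) * negWeight 0) + Q (1 ℕ.+ 6 ℕ.* a) * negSum n a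
  negSum-sucA n a = begin
    negSum (suc n) (suc a)
      ≈⟨ ΣS-snoc (suc a) (λ i → G (suc n) (suc a ∸ i) * negWeight i) ⟩
    ΣS (suc a) (λ i → G (suc n) (suc a ∸ i) * negWeight i) + G (suc n) (a ∸ a) * negWeight (suc a)
      ≈⟨ +-cong (≈trans (ΣS-cong (suc a) (λ i i<sa → ≈trans (*-cong (≈trans (G-cong _ _ _ _ P.refl (NP.+-∸-assoc 1 (NP.<⇒≤pred i<sa))) (Pascal-A n (a ∸ i))) ≈refl) (distribʳ _ _ _)))
                       (ΣS-+ (suc a) (λ i → G n (a ∸ i) * negWeight i) (λ i → Q (6 ℕ.+ 6 ℕ.* (a ∸ i)) * G n (suc (a ∸ i)) * negWeight i)))
                (*-cong (≈trans (G-cong _ _ _ _ P.refl (NP.n∸n≡0 a)) (≈trans (G-zero (suc n)) (≈trans (≈sym (G-zero n)) (G-cong _ _ _ _ P.refl (P.sym (NP.n∸n≡0 a)))))) weight-step) ⟩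
    (negSum n a + ΣS (suc a) (λ i → Q (6 ℕ.+ 6 ℕ.* (a ∸ i)) * G n (suc (a ∸ i)) * negWeight i)) + G n (a ∸ a) * (y * negWeight a)
      ≈⟨ +-cong (+-cong ≈refl (ΣS-suc a (λ i → Q (6 ℕ.+ 6 ℕ.* (a ∸ i)) * G n (suc (a ∸ i)) * negWeight i))) ≈refl ⟩
    (negSum n a + (Q (6 ℕ.+ 6 ℕ.* a) * G n (suc a) * negWeight 0 + ΣS a (λ i → Q (6 ℕ.+ 6 ℕ.* (a ∸ suc i)) * G n (suc (a ∸ suc i)) * negWeight (suc i)))) + G n (a ∸ a) * (y * negWeight a)
      ≈⟨ +-cong (+-cong ≈refl (+-cong (*-assoc _ _ _) (≈trans (ΣS-cong a (λ i i<a → ≈trans (*-cong (*-cong ≈refl (G-cong _ _ _ _ P.refl (P.sym (NP.+-∸-assoc 1 i<a)))) ≈refl) (swapQ _ _ _ _ _ (weight-shift i i<a)))) (≈sym (ΣS-*ˡ a (λ i → G n (a ∸ i) * negWeight i) y))))) (regroup₁ (G n (a ∸ a)) y (negWeight a)) ⟩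
    (negSum n a + (W + y * ΣS a (λ i → G n (a ∸ i) * negWeight i))) + y * (G n (a ∸ a) * negWeight a)
      ≈⟨ regroup₂ (negSum n a) W y (ΣS a (λ i → G n (a ∸ i) * negWeight i)) (G n (a ∸ a) * negWeight a) ⟩
    negSum n a + W + y * (ΣS a (λ i → G n (a ∸ i) * negWeight i) + G n (a ∸ a) * negWeight a)
      ≈⟨ +-cong ≈refl (*-cong ≈refl (≈sym (ΣS-snoc a (λ i → G n (a ∸ i) * negWeight i)))) ⟩
    negSum n a + W + y * negSum n a ∎
    where
    open SetoidR setoid
    y = Q (1 ℕ.+ 6 ℕ.* a)
    W = Q (6 ℕ.+ 6 ℕ.* a) * (G n (suc a) * negWeight 0)
    weight-step : negWeight (suc a) ≈ y * negWeight a
    weight-step = ≈sym (Q-+≡ _ _ _ (arith a (tri a)))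
      where
      arith : ∀ a t → 1 ℕ.+ 6 ℕ.* a ℕ.+ (6 ℕ.* t ℕ.+ a) ≡ 6 ℕ.* (a ℕ.+ t) ℕ.+ suc a
      arith = solve-∀
    weight-shift : ∀ i → i < a → Q (6 ℕ.+ 6 ℕ.* (a ∸ suc i)) * negWeight (suc i) ≈ y * negWeight i
    weight-shift i i<a = ≈trans (Q-+ _ _) (≈trans (Q-cong arith) (≈sym (Q-+ _ _)))
      where
      d = a ∸ suc i
      arith′ : ∀ d i t → 6 ℕ.+ 6 ℕ.* d ℕ.+ (6 ℕ.* (i ℕ.+ t) ℕ.+ suc i) ≡ 1 ℕ.+ 6 ℕ.* (suc i ℕ.+ d) ℕ.+ (6 ℕ.* t ℕ.+ i)
      arith′ = solve-∀
      arith : 6 ℕ.+ 6 ℕ.* d ℕ.+ (6 ℕ.* tri (suc i) ℕ.+ suc i) ≡ 1 ℕ.+ 6 ℕ.* a ℕ.+ (6 ℕ.* tri i ℕ.+ i)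
      arith = P.trans (arith′ d i (tri i)) (P.cong (λ z → 1 ℕ.+ 6 ℕ.* z ℕ.+ (6 ℕ.* tri i ℕ.+ i)) (NP.m+[n∸m]≡n i<a))
    regroup₁ : ∀ g y z → g * (y * z) ≈ y * (g * z)
    regroup₁ = solve 3 (λ g y z → g :* (y :* z) := y :* (g :* z)) ≈refl
    regroup₂ : ∀ p w y s t → (p + (w + y * s)) + y * t ≈ p + w + y * (s + t)
    regroup₂ = solve 5 (λ p w y s t → (p :+ (w :+ y :* s)) :+ y :* t := p :+ w :+ y :* (s :+ t)) ≈refl

  posSum-sucA : ∀ n a b → n ≡ a ℕ.+ b → posSum (suc n) (suc a) b + Q (6 ℕ.+ 6 ℕ.* a) * (G n (suc a) * negWeight 0) ≈ posSum n a b + Q (1 ℕ.+ 6 ℕ.* a) * posSum n a b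
  posSum-sucA n a zero e = ≈trans (+-cong (ΣS-0 _) (≈trans (*-cong ≈refl (≈trans (*-cong (G-out n (suc a) (P.subst (_< suc a) (P.sym (P.trans e (NP.+-identityʳ a))) NP.≤-refl)) ≈refl) (zeroˡ _))) (zeroʳ _)))
                       (≈sym (+-cong (ΣS-0 _) (≈trans (*-cong ≈refl (ΣS-0 _)) (zeroʳ _))))
  posSum-sucA n a (suc b) e = begin
    posSum (suc n) (suc a) (suc b) + W
      ≈⟨ +-cong (≈trans (ΣS-cong' (suc b) (λ i → ≈trans (*-cong (Pascal-A n (suc a ℕ.+ i)) ≈refl) (distribʳ _ _ _)))
                        (ΣS-+ (suc b) (λ i → G n (suc a ℕ.+ i) * posWeight i) (λ i → Q (6 ℕ.+ 6 ℕ.* (suc a ℕ.+ i)) * G n (suc (suc a ℕ.+ i)) * posWeight i))) ≈refl ⟩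
    (posSum n a (suc b) + ΣS (suc b) (λ i → Q (6 ℕ.+ 6 ℕ.* (suc a ℕ.+ i)) * G n (suc (suc a ℕ.+ i)) * posWeight i)) + W
      ≈⟨ +-cong (+-cong ≈refl (ΣS-snoc b (λ i → Q (6 ℕ.+ 6 ℕ.* (suc a ℕ.+ i)) * G n (suc (suc a ℕ.+ i)) * posWeight i))) ≈refl ⟩
    (posSum n a (suc b) + (ΣS b (λ i → Q (6 ℕ.+ 6 ℕ.* (suc a ℕ.+ i)) * G n (suc (suc a ℕ.+ i)) * posWeight i) + Q (6 ℕ.+ 6 ℕ.* (suc a ℕ.+ b)) * G n (suc (suc a ℕ.+ b)) * posWeight b)) + W
      ≈⟨ +-cong (+-cong ≈refl (≈trans (+-cong (≈trans (ΣS-cong b (λ i i<b → swapQ _ _ _ _ _ (weight-shift i))) (≈sym (ΣS-*ˡ b (λ i → G n (suc (suc a ℕ.+ i)) * posWeight (suc i)) y)))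
                                              (≈trans (*-cong (*-cong ≈refl (G-out n _ n<top)) ≈refl) (≈trans (*-cong (zeroʳ _) ≈refl) (zeroˡ _)))) (+-identityʳ _))) ≈refl ⟩
    (posSum n a (suc b) + y * ΣS b (λ i → G n (suc (suc a ℕ.+ i)) * posWeight (suc i))) + W
      ≈⟨ +-cong (+-cong ≈refl (*-cong ≈refl (ΣS-cong' b (λ i → *-cong (G-cong _ _ _ _ P.refl (P.sym (P.cong suc (NP.+-suc a i)))) ≈refl)))) (≈sym boundary-term) ⟩
    (posSum n a (suc b) + y * ΣS b (λ i → G n (suc a ℕ.+ suc i) * posWeight (suc i))) + y * (G n (suc a ℕ.+ 0) * posWeight 0)
      ≈⟨ regroup₃ (posSum n a (suc b)) y (ΣS b (λ i → G n (suc a ℕ.+ suc i) * posWeight (suc i))) (G n (suc a ℕ.+ 0) * posWeight 0) ⟩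
    posSum n a (suc b) + y * (G n (suc a ℕ.+ 0) * posWeight 0 + ΣS b (λ i → G n (suc a ℕ.+ suc i) * posWeight (suc i)))
      ≈⟨ +-cong ≈refl (*-cong ≈refl (≈sym (ΣS-suc b (λ i → G n (suc a ℕ.+ i) * posWeight i)))) ⟩
    posSum n a (suc b) + y * posSum n a (suc b) ∎
    where
    open SetoidR setoid
    y = Q (1 ℕ.+ 6 ℕ.* a)
    W = Q (6 ℕ.+ 6 ℕ.* a) * (G n (suc a) * negWeight 0)
    n<top : n < suc (suc a ℕ.+ b)
    n<top = P.subst (_< suc (suc a ℕ.+ b)) (P.sym (P.trans e (NP.+-suc a b))) (NP.n<1+n _)
    weight-shift : ∀ i → Q (6 ℕ.+ 6 ℕ.* (suc a ℕ.+ i)) * posWeight i ≈ y * posWeight (suc i)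
    weight-shift i = ≈trans (Q-+ _ _) (≈trans (Q-cong (arith a i (tri i))) (≈sym (Q-+ _ _)))
      where
      arith : ∀ a i t → 6 ℕ.+ 6 ℕ.* (suc a ℕ.+ i) ℕ.+ (6 ℕ.* (i ℕ.+ t) ℕ.+ 5 ℕ.* suc i) ≡ 1 ℕ.+ 6 ℕ.* a ℕ.+ (6 ℕ.* (suc i ℕ.+ (i ℕ.+ t)) ℕ.+ 5 ℕ.* suc (suc i))
      arith = solve-∀
    boundary-term : y * (G n (suc a ℕ.+ 0) * posWeight 0) ≈ W
    boundary-term = ≈trans (*-cong ≈refl (*-cong (G-cong _ _ _ _ P.refl (P.cong suc (NP.+-identityʳ a))) ≈refl))
          (≈trans (≈sym (*-assoc _ _ _)) (≈trans (swapQ y (G n (suc a)) (posWeight 0) (Q (6 ℕ.+ 6 ℕ.* a)) (negWeight 0) (≈trans (Q-+ _ _) (≈trans (Q-cong (arith a)) (≈sym (Q-+ _ _))))) ≈refl))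
      where
      arith : ∀ a → 1 ℕ.+ 6 ℕ.* a ℕ.+ (6 ℕ.* 0 ℕ.+ 5 ℕ.* 1) ≡ 6 ℕ.+ 6 ℕ.* a ℕ.+ (6 ℕ.* 0 ℕ.+ 0)
      arith = solve-∀
    regroup₃ : ∀ p y s t → (p + y * s) + y * t ≈ p + y * (t + s)
    regroup₃ = solve 4 (λ p y s t → (p :+ y :* s) :+ y :* t := p :+ y :* (t :+ s)) ≈refl

  tripleSum : ℕ → ℕ → S
  tripleSum a b = negSum (a ℕ.+ b) a + posSum (a ℕ.+ b) a b

  tripleSum-sucA : ∀ a b → tripleSum (suc a) b ≈ tripleSum a b * fac m1 (1 ℕ.+ 6 ℕ.* a)
  tripleSum-sucA a b = begin
    negSum (suc n) (suc a) + posSum (suc n) (suc a) b                ≈⟨ +-cong (negSum-sucA n a) ≈refl ⟩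
    (negSum n a + W + y * negSum n a) + posSum (suc n) (suc a) b    ≈⟨ regroup₁ (negSum n a) W y (posSum (suc n) (suc a) b) ⟩
    negSum n a + y * negSum n a + (posSum (suc n) (suc a) b + W)    ≈⟨ +-cong ≈refl (posSum-sucA n a b P.refl) ⟩
    negSum n a + y * negSum n a + (posSum n a b + y * posSum n a b) ≈⟨ regroup₂ (negSum n a) (posSum n a b) y ⟩
    (negSum n a + posSum n a b) * (κ (+ 1) - κ m1 * y)              ∎
    where
    open SetoidR setoid
    n = a ℕ.+ b
    y = Q (1 ℕ.+ 6 ℕ.* a)
    W = Q (6 ℕ.+ 6 ℕ.* a) * (G n (suc a) * negWeight 0)
    regroup₁ : ∀ p w y q → (p + w + y * p) + q ≈ p + y * p + (q + w)
    regroup₁ = solve 4 (λ p w y q → (p :+ w :+ y :* p) :+ q := p :+ y :* p :+ (q :+ w)) ≈refl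
    regroup₂ : ∀ p q y → p + y * p + (q + y * q) ≈ (p + q) * (κ (+ 1) - κ m1 * y)
    regroup₂ = solve 3 (λ p q y → p :+ y :* p :+ (q :+ y :* q) := (p :+ q) :* (con (+ 1) :- con m1 :* y)) ≈refl

  tripleSum-sucB : ∀ b → tripleSum 0 (suc b) ≈ tripleSum 0 b * fac m1 (5 ℕ.+ 6 ℕ.* b)
  tripleSum-sucB b = begin
    negSum (suc b) 0 + posSum (suc b) 0 (suc b)
      ≈⟨ +-cong (negSum-sucB b 0 b P.refl) (posSum-sucB b 0 b P.refl) ⟩
    (negSum b 0 + x * negTail b 0) + (posSum b 0 b + x * (G b 0 * negWeight 0) + x * posSum b 0 b)
      ≈⟨ regroup₁ (negSum b 0) x (negTail b 0) (posSum b 0 b) (G b 0 * negWeight 0) ⟩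
    (negSum b 0 + posSum b 0 b) + x * (G b 0 * negWeight 0 + negTail b 0) + x * posSum b 0 b
      ≈⟨ +-cong (+-cong ≈refl (*-cong ≈refl (≈sym (negSum-split b 0)))) ≈refl ⟩
    (negSum b 0 + posSum b 0 b) + x * negSum b 0 + x * posSum b 0 b
      ≈⟨ regroup₂ (negSum b 0) (posSum b 0 b) x ⟩
    (negSum b 0 + posSum b 0 b) * (κ (+ 1) - κ m1 * x) ∎
    where
    open SetoidR setoid
    x = Q (5 ℕ.+ 6 ℕ.* b)
    regroup₁ : ∀ p x r q g → (p + x * r) + (q + x * g + x * q) ≈ (p + q) + x * (g + r) + x * q
    regroup₁ = solve 5 (λ p x r q g → (p :+ x :* r) :+ (q :+ x :* g :+ x :* q) := (p :+ q) :+ x :* (g :+ r) :+ x :* q) ≈refl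
    regroup₂ : ∀ p q x → (p + q) + x * p + x * q ≈ (p + q) * (κ (+ 1) - κ m1 * x)
    regroup₂ = solve 3 (λ p q x → (p :+ q) :+ x :* p :+ x :* q := (p :+ q) :* (con (+ 1) :- con m1 :* x)) ≈refl

  finite-triple-product : ∀ a b → tripleSum a b ≈ Po m1 1 6 a * Po m1 5 6 b
  finite-triple-product zero zero = begin
    negSum 0 0 + posSum 0 0 0
      ≈⟨ +-cong (≈trans (ΣS-suc 0 (λ i → G 0 (0 ∸ i) * negWeight i)) (≈trans (+-cong (*-cong (G-zero 0) negWeight-0) (ΣS-0 _)) (≈trans (+-identityʳ _) (*-identityʳ _)))) (ΣS-0 _) ⟩
    1# + 0#                     ≈⟨ +-identityʳ _ ⟩
    1#                          ≈⟨ ≈sym (≈trans (*-cong (Po-0 m1 1 6) (Po-0 m1 5 6)) (*-identityʳ _)) ⟩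
    Po m1 1 6 0 * Po m1 5 6 0   ∎
    where open SetoidR setoid
  finite-triple-product (suc a) b = begin
    tripleSum (suc a) b                                    ≈⟨ tripleSum-sucA a b ⟩
    tripleSum a b * fac m1 (1 ℕ.+ 6 ℕ.* a)                 ≈⟨ *-cong (finite-triple-product a b) ≈refl ⟩
    Po m1 1 6 a * Po m1 5 6 b * fac m1 (1 ℕ.+ 6 ℕ.* a)     ≈⟨ swap-last _ _ _ ⟩
    Po m1 1 6 a * fac m1 (1 ℕ.+ 6 ℕ.* a) * Po m1 5 6 b     ≈⟨ *-cong (≈sym (Po-snoc m1 1 6 a)) ≈refl ⟩
    Po m1 1 6 (suc a) * Po m1 5 6 b                        ∎
    where
    open SetoidR setoid
    swap-last : ∀ a b c → a * b * c ≈ a * c * b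
    swap-last = solve 3 (λ a b c → a :* b :* c := a :* c :* b) ≈refl
  finite-triple-product zero (suc b) = begin
    tripleSum 0 (suc b)                                    ≈⟨ tripleSum-sucB b ⟩
    tripleSum 0 b * fac m1 (5 ℕ.+ 6 ℕ.* b)                 ≈⟨ *-cong (finite-triple-product zero b) ≈refl ⟩
    Po m1 1 6 0 * Po m1 5 6 b * fac m1 (5 ℕ.+ 6 ℕ.* b)     ≈⟨ *-assoc _ _ _ ⟩
    Po m1 1 6 0 * (Po m1 5 6 b * fac m1 (5 ℕ.+ 6 ℕ.* b))   ≈⟨ *-cong ≈refl (≈sym (Po-snoc m1 5 6 b)) ⟩
    Po m1 1 6 0 * Po m1 5 6 (suc b)                        ∎
    where open SetoidR setoid

module SymmetricSums where

  open import Defs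
  open SeriesRing
  open SeriesSums
  open QFactorials
  open import Data.Nat as ℕ using (ℕ; zero; suc; _∸_; _≤_; _<_)
  import Data.Nat.Properties as NP
  open import Data.Integer as ℤ using (ℤ; +_; -[1+_])
  import Data.Integer.Properties as ZP
  open import Data.List using (map; upTo)
  import Data.List.Properties as LP
  open import Function using (_∘_)
  open import Relation.Binary.PropositionalEquality as P using (_≡_)
  import Relation.Binary.Reasoning.Setoid as SetoidR
  open import Data.Nat.Tactic.RingSolver using (solve-∀)
  open import Data.Product using (_×_; _,_; proj₁; proj₂)

  opaque
    Rz : ℤ → S
    Rz z = ⟨ recipQfacℤ 6 z ⟩

  opaque
    unfolding Rz R
    Rz-pos : ∀ n → Rz (+ n) ≈ R n
    Rz-pos n = ≈refl
    Rz-neg : ∀ n → Rz -[1+ n ] ≈ 0#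
    Rz-neg n = 𝟘-def

  Rz-negpos : ∀ d → 0 < d → Rz (ℤ.- (+ d)) ≈ 0#
  Rz-negpos (suc d) _ = Rz-neg d

  Rd : ℕ → ℕ → S
  Rd N n = Rz (+ N ℤ.- + n)

  Rd-in : ∀ N n → n ≤ N → Rd N n ≈ R (N ∸ n)
  Rd-in N n n≤N = ≈trans (≈≡ (P.cong Rz (P.trans (ZP.m-n≡m⊖n N n) (ZP.⊖-≥ n≤N)))) (Rz-pos (N ∸ n))

  Rd-out : ∀ N n → N < n → Rd N n ≈ 0#
  Rd-out N n N<n = ≈trans (≈≡ (P.cong Rz (P.trans (ZP.m-n≡m⊖n N n) (ZP.⊖-< N<n)))) (Rz-negpos (n ∸ N) (NP.m<n⇒0<n∸m N<n))

  SymS : ℕ → (ℤ → S) → S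
  SymS zero h = h (+ 0)
  SymS (suc M) h = h -[1+ M ] + SymS M h + h (+ suc M)

  SymS-cong : ∀ M {h h'} → (∀ j → h j ≈ h' j) → SymS M h ≈ SymS M h'
  SymS-cong zero e = e (+ 0)
  SymS-cong (suc M) e = +-cong (+-cong (e _) (SymS-cong M e)) (e _)

  SymS-*ˡ : ∀ M h c → c * SymS M h ≈ SymS M (λ j → c * h j)
  SymS-*ˡ zero h c = ≈refl
  SymS-*ˡ (suc M) h c = ≈trans (distribˡ c _ _) (+-cong (≈trans (distribˡ c _ _) (+-cong ≈refl (SymS-*ˡ M h c))) ≈refl)

  SymS-ΣS : ∀ M n (F : ℕ → ℤ → S) → SymS M (λ j → ΣS n (λ k → F k j)) ≈ ΣS n (λ k → SymS M (F k))
  SymS-ΣS zero n F = ≈refl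
  SymS-ΣS (suc M) n F = ≈trans (+-cong (+-cong ≈refl (SymS-ΣS M n F)) ≈refl)
    (≈trans (+-cong (≈sym (ΣS-+ n (λ k → F k -[1+ M ]) (λ k → SymS M (F k)))) ≈refl)
            (≈sym (ΣS-+ n (λ k → F k -[1+ M ] + SymS M (F k)) (λ k → F k (+ suc M)))))

  SymS-ext : ∀ M d h → (∀ n → M ≤ n → h -[1+ n ] ≈ 0# × h (+ suc n) ≈ 0#) → SymS (d ℕ.+ M) h ≈ SymS M h
  SymS-ext M zero h z = ≈refl
  SymS-ext M (suc d) h z = ≈trans (+-cong (+-cong (proj₁ (z (d ℕ.+ M) (NP.m≤n+m M d))) (SymS-ext M d h z)) (proj₂ (z (d ℕ.+ M) (NP.m≤n+m M d))))
    (≈trans (+-cong (+-identityˡ _) ≈refl) (+-identityʳ _))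

  SymS-split : ∀ M (h : ℤ → S) → SymS M h ≈ ΣS (suc M) (λ i → h (ℤ.- (+ i))) + ΣS M (λ i → h (+ suc i))
  SymS-split zero h = ≈sym (≈trans (+-cong (≈trans (ΣS-suc 0 (λ i → h (ℤ.- (+ i)))) (≈trans (+-cong ≈refl (ΣS-0 _)) (+-identityʳ _))) (ΣS-0 _)) (+-identityʳ _))
  SymS-split (suc M) h = begin
    h -[1+ M ] + SymS M h + h (+ suc M) ≈⟨ +-cong (+-cong ≈refl (SymS-split M h)) ≈refl ⟩
    h -[1+ M ] + (A + B) + h (+ suc M) ≈⟨ regroup (h -[1+ M ]) A B (h (+ suc M)) ⟩
    (A + h -[1+ M ]) + (B + h (+ suc M)) ≈⟨ +-cong (≈sym (ΣS-snoc (suc M) (λ i → h (ℤ.- (+ i))))) (≈sym (ΣS-snoc M (λ i → h (+ suc i)))) ⟩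
    ΣS (suc (suc M)) (λ i → h (ℤ.- (+ i))) + ΣS (suc M) (λ i → h (+ suc i)) ∎
    where
    open SetoidR setoid
    A = ΣS (suc M) (λ i → h (ℤ.- (+ i)))
    B = ΣS M (λ i → h (+ suc i))
    regroup : ∀ x a b y → x + (a + b) + y ≈ (a + x) + (b + y)
    regroup = solve 4 (λ x a b y → x :+ (a :+ b) :+ y := (a :+ x) :+ (b :+ y)) ≈refl

  SymS-range : ∀ M (h : ℤ → S) → ΣS (suc (2 ℕ.* M)) (λ i → h (+ i ℤ.- + M)) ≈ SymS M h
  SymS-range zero h = ≈trans (ΣS-suc 0 (λ i → h (+ i ℤ.- + 0))) (≈trans (+-cong ≈refl (ΣS-0 _)) (+-identityʳ _))
  SymS-range (suc M) h = begin
    ΣS (suc (2 ℕ.* suc M)) g ≈⟨ ΣS-count g (P.cong suc (NP.*-suc 2 M)) ⟩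
    ΣS (suc (suc (suc (2 ℕ.* M)))) g ≈⟨ ΣS-suc (suc (suc (2 ℕ.* M))) g ⟩
    g 0 + ΣS (suc (suc (2 ℕ.* M))) (g ∘ suc) ≈⟨ +-cong ≈refl (ΣS-snoc (suc (2 ℕ.* M)) (g ∘ suc)) ⟩
    g 0 + (ΣS (suc (2 ℕ.* M)) (g ∘ suc) + g (suc (suc (2 ℕ.* M))))
      ≈⟨ +-cong (≈≡ (P.cong h first-index)) (+-cong (ΣS-cong' (suc (2 ℕ.* M)) (λ i → ≈≡ (P.cong h (middle-index i)))) (≈≡ (P.cong h last-index))) ⟩
    h -[1+ M ] + (ΣS (suc (2 ℕ.* M)) (λ i → h (+ i ℤ.- + M)) + h (+ suc M)) ≈⟨ ≈sym (+-assoc _ _ _) ⟩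
    h -[1+ M ] + ΣS (suc (2 ℕ.* M)) (λ i → h (+ i ℤ.- + M)) + h (+ suc M) ≈⟨ +-cong (+-cong ≈refl (SymS-range M h)) ≈refl ⟩
    SymS (suc M) h ∎
    where
    open SetoidR setoid
    g : ℕ → S
    g i = h (+ i ℤ.- + suc M)
    first-index : + 0 ℤ.- + suc M ≡ -[1+ M ]
    first-index = P.refl
    middle-index : ∀ i → + suc i ℤ.- + suc M ≡ + i ℤ.- + M
    middle-index i = P.trans (ZP.m-n≡m⊖n (suc i) (suc M)) (P.trans (ZP.[1+m]⊖[1+n]≡m⊖n i M) (P.sym (ZP.m-n≡m⊖n i M)))
    last-index : + suc (suc (2 ℕ.* M)) ℤ.- + suc M ≡ + suc M
    last-index = P.trans (ZP.m-n≡m⊖n (suc (suc (2 ℕ.* M))) (suc M)) (P.trans (ZP.⊖-≥ in-range) (P.cong +_ complement))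
      where
      arith : ∀ M → suc (suc (2 ℕ.* M)) ≡ suc M ℕ.+ suc M
      arith = solve-∀
      in-range : suc M ≤ suc (suc (2 ℕ.* M))
      in-range = P.subst (suc M ≤_) (P.sym (arith M)) (NP.m≤m+n (suc M) (suc M))
      complement : suc (suc (2 ℕ.* M)) ∸ suc M ≡ suc M
      complement = P.trans (P.cong (_∸ suc M) (arith M)) (NP.m+n∸m≡n (suc M) (suc M))

  sym-link : ∀ M (f : ℤ → Series) → ⟨ sumS (map f (symRange M)) ⟩ ≈ SymS M (λ j → ⟨ f j ⟩)
  sym-link M f = ≈trans (≈≡ (P.cong (λ l → ⟨ sumS l ⟩) (P.sym (LP.map-∘ {g = f} {f = λ i → + i ℤ.- + M} (upTo (suc (2 ℕ.* M)))))))
                        (≈trans (sumS-upTo (suc (2 ℕ.* M)) (λ i → f (+ i ℤ.- + M))) (SymS-range M (λ j → ⟨ f j ⟩)))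

  opaque
    unfolding Rz
    Rz-def : ∀ z → ⟨ recipQfacℤ 6 z ⟩ ≈ Rz z
    Rz-def z = ≈refl

module Exponents where

  open import Data.Nat as ℕ using (ℕ; suc)
  open import Data.Integer as ℤ using (ℤ; +_; -[1+_]; ∣_∣)
  import Data.Integer.Properties as ZP
  open import Relation.Binary.PropositionalEquality as P using (_≡_)
  import Data.Integer.Tactic.RingSolver as ZS
  import Data.Nat.Tactic.RingSolver as NS

  Eℤ : ℕ → ℤ → ℤ
  Eℤ ν j = + (3 ℕ.* (ν ℕ.+ 1)) ℤ.* j ℤ.* j ℤ.+ + 2 ℤ.* j

  E : ℕ → ℤ → ℕ
  E ν j = ∣ Eℤ ν j ∣

  E' : ℕ → ℤ → ℕ
  E' ν (+ n) = 3 ℕ.* (ν ℕ.+ 1) ℕ.* n ℕ.* n ℕ.+ 2 ℕ.* n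
  E' ν -[1+ n ] = suc n ℕ.* (3 ℕ.* (ν ℕ.+ 1) ℕ.* n ℕ.+ 3 ℕ.* ν ℕ.+ 1)

  -- the exponent is non-negative, so E agrees with E'
  E≡E' : ∀ ν j → E ν j ≡ E' ν j
  E≡E' ν (+ n) = P.cong ∣_∣ eq
    where
    eq : Eℤ ν (+ n) ≡ + (3 ℕ.* (ν ℕ.+ 1) ℕ.* n ℕ.* n ℕ.+ 2 ℕ.* n)
    eq = P.sym (P.trans (ZP.pos-+ (3 ℕ.* (ν ℕ.+ 1) ℕ.* n ℕ.* n) (2 ℕ.* n)) (P.cong₂ ℤ._+_ (P.trans (ZP.pos-* (3 ℕ.* (ν ℕ.+ 1) ℕ.* n) n) (P.cong (ℤ._* + n) (ZP.pos-* (3 ℕ.* (ν ℕ.+ 1)) n))) (ZP.pos-* 2 n)))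
  E≡E' ν -[1+ n ] = P.cong ∣_∣ eq
    where
    A = 3 ℕ.* (ν ℕ.+ 1)
    B = A ℕ.* n ℕ.+ 3 ℕ.* ν ℕ.+ 1
    castA : + A ≡ + 3 ℤ.* (+ ν ℤ.+ + 1)
    castA = P.trans (ZP.pos-* 3 (ν ℕ.+ 1)) (P.cong (+ 3 ℤ.*_) (ZP.pos-+ ν 1))
    castB : + B ≡ + A ℤ.* + n ℤ.+ + 3 ℤ.* + ν ℤ.+ + 1
    castB = P.trans (ZP.pos-+ (A ℕ.* n ℕ.+ 3 ℕ.* ν) 1) (P.cong (ℤ._+ + 1) (P.trans (ZP.pos-+ (A ℕ.* n) (3 ℕ.* ν)) (P.cong₂ ℤ._+_ (ZP.pos-* A n) (ZP.pos-* 3 ν))))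
    castSuc : + suc n ≡ + n ℤ.+ + 1
    castSuc = P.trans (P.cong +_ (NP.+-comm 1 n)) (ZP.pos-+ n 1)
      where import Data.Nat.Properties as NP
    poly : ∀ v m → (+ 3 ℤ.* (v ℤ.+ + 1)) ℤ.* (ℤ.- (m ℤ.+ + 1)) ℤ.* (ℤ.- (m ℤ.+ + 1)) ℤ.+ + 2 ℤ.* (ℤ.- (m ℤ.+ + 1))
                 ≡ (m ℤ.+ + 1) ℤ.* ((+ 3 ℤ.* (v ℤ.+ + 1)) ℤ.* m ℤ.+ + 3 ℤ.* v ℤ.+ + 1)
    poly = ZS.solve-∀
    eq : Eℤ ν -[1+ n ] ≡ + (suc n ℕ.* B)
    eq = P.trans (P.cong (λ a → a ℤ.* -[1+ n ] ℤ.* -[1+ n ] ℤ.+ + 2 ℤ.* -[1+ n ]) castA)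
         (P.trans (P.cong (λ s → (+ 3 ℤ.* (+ ν ℤ.+ + 1)) ℤ.* (ℤ.- s) ℤ.* (ℤ.- s) ℤ.+ + 2 ℤ.* (ℤ.- s)) castSuc)
         (P.trans (poly (+ ν) (+ n))
         (P.sym (P.trans (ZP.pos-* (suc n) B) (P.cong₂ ℤ._*_ castSuc (P.trans castB (P.cong (λ a → a ℤ.* + n ℤ.+ + 3 ℤ.* + ν ℤ.+ + 1) castA)))))))

  E'-step : ∀ ν j → E' ν j ℕ.+ 3 ℕ.* (∣ j ∣ ℕ.* ∣ j ∣) ≡ E' (suc ν) j
  E'-step ν (+ n) = arith ν n
    where
    arith : ∀ ν n → 3 ℕ.* (ν ℕ.+ 1) ℕ.* n ℕ.* n ℕ.+ 2 ℕ.* n ℕ.+ 3 ℕ.* (n ℕ.* n) ≡ 3 ℕ.* (suc ν ℕ.+ 1) ℕ.* n ℕ.* n ℕ.+ 2 ℕ.* n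
    arith = NS.solve-∀
  E'-step ν -[1+ n ] = arith ν n
    where
    arith : ∀ ν n → suc n ℕ.* (3 ℕ.* (ν ℕ.+ 1) ℕ.* n ℕ.+ 3 ℕ.* ν ℕ.+ 1) ℕ.+ 3 ℕ.* (suc n ℕ.* suc n) ≡ suc n ℕ.* (3 ℕ.* (suc ν ℕ.+ 1) ℕ.* n ℕ.+ 3 ℕ.* suc ν ℕ.+ 1)
    arith = NS.solve-∀

  E-step : ∀ ν j → E ν j ℕ.+ 3 ℕ.* (∣ j ∣ ℕ.* ∣ j ∣) ≡ E (suc ν) j
  E-step ν j = P.trans (P.cong (ℕ._+ 3 ℕ.* (∣ j ∣ ℕ.* ∣ j ∣)) (E≡E' ν j)) (P.trans (E'-step ν j) (P.sym (E≡E' (suc ν) j)))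

module BaileyChain where

  open SeriesRing
  open SeriesSums
  open QFactorials
  open BaileyKernel
  open SymmetricSums
  open Exponents
  open import Data.Nat as ℕ using (ℕ; suc; _∸_; _≤_; _<_; s≤s)
  import Data.Nat.Properties as NP
  open import Data.Integer as ℤ using (ℤ; +_; -[1+_]; ∣_∣)
  open import Relation.Binary.PropositionalEquality as P using (_≡_)
  import Relation.Binary.Reasoning.Setoid as SetoidR
  open import Data.Nat.Tactic.RingSolver using (solve-∀)
  open import Data.Product using (_×_; _,_; proj₁; proj₂)
  open import Relation.Nullary using (yes; no)

  Po3 : ℕ → S
  Po3 N = Po m1 3 6 N

  Q3 : ℕ → S
  Q3 N = Q (3 ℕ.* (N ℕ.* N))

  -- Terms with N < n vanish; the rest is bailey-kernel with j = n, m = M - n.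
  kernel-nat : ∀ M n → ΣS (suc M) (λ N → Q3 N * Po3 N * R (M ∸ N) * (Rd N n * R (N ℕ.+ n)))
                   ≈ Po3 M * Q3 n * (Rd M n * R (M ℕ.+ n))
  kernel-nat M n with n ℕ.≤? M
  ... | no n≰M = ≈trans (ΣS-zero (suc M) _ (λ N N<sM → vanishing N (NP.<-≤-trans N<sM (NP.≰⇒> n≰M))))
                                     (≈sym (≈trans (*-cong ≈refl (≈trans (*-cong (Rd-out M n (NP.≰⇒> n≰M)) ≈refl) (zeroˡ _))) (zeroʳ _)))
    where
    vanishing : ∀ N → N < n → Q3 N * Po3 N * R (M ∸ N) * (Rd N n * R (N ℕ.+ n)) ≈ 0#
    vanishing N N<n = ≈trans (*-cong ≈refl (≈trans (*-cong (Rd-out N n N<n) ≈refl) (zeroˡ _))) (zeroʳ _)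
  ... | yes n≤M = begin
    ΣS (suc M) f ≈⟨ ΣS-count f length ⟩
    ΣS (n ℕ.+ suc m) f ≈⟨ ΣS-split n (suc m) f ⟩
    ΣS n f + ΣS (suc m) (λ k → f (n ℕ.+ k))
      ≈⟨ +-cong (ΣS-zero n f (λ N N<n → ≈trans (*-cong ≈refl (≈trans (*-cong (Rd-out N n N<n) ≈refl) (zeroˡ _))) (zeroʳ _))) (ΣS-cong (suc m) (λ k k<sm → term k (NP.<⇒≤pred k<sm))) ⟩
    0# + ΣS (suc m) (λ k → Q (3 ℕ.* ((n ℕ.+ k) ℕ.* (n ℕ.+ k))) * Po m1 3 6 (n ℕ.+ k) * R k * R (m ∸ k) * R (2 ℕ.* n ℕ.+ k))
      ≈⟨ ≈trans (+-identityˡ _) (bailey-kernel n m) ⟩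
    Po m1 3 6 (n ℕ.+ m) * Q (3 ℕ.* (n ℕ.* n)) * R m * R (2 ℕ.* n ℕ.+ m)
      ≈⟨ ≈trans (*-assoc _ _ _) (*-cong (*-cong (≈≡ (P.cong Po3 n+m≡M)) ≈refl) (*-cong (≈sym (Rd-in M n n≤M)) (≈≡ (P.cong R (P.trans (arith₂ n m) (P.cong (ℕ._+ n) n+m≡M)))))) ⟩
    Po3 M * Q3 n * (Rd M n * R (M ℕ.+ n)) ∎
    where
    open SetoidR setoid
    m = M ∸ n
    f : ℕ → S
    f N = Q3 N * Po3 N * R (M ∸ N) * (Rd N n * R (N ℕ.+ n))
    n+m≡M : n ℕ.+ m ≡ M
    n+m≡M = NP.m+[n∸m]≡n n≤M
    length : suc M ≡ n ℕ.+ suc m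
    length = P.trans (P.cong suc (P.sym n+m≡M)) (P.sym (NP.+-suc n m))
    arith₂ : ∀ n m → 2 ℕ.* n ℕ.+ m ≡ n ℕ.+ m ℕ.+ n
    arith₂ = solve-∀
    arith₃ : ∀ n k → n ℕ.+ k ℕ.+ n ≡ 2 ℕ.* n ℕ.+ k
    arith₃ = solve-∀
    regroup : ∀ a b c x y → a * b * c * (x * y) ≈ a * b * x * c * y
    regroup = solve 5 (λ a b c x y → a :* b :* c :* (x :* y) := a :* b :* x :* c :* y) ≈refl
    term : ∀ k → k ≤ m → f (n ℕ.+ k) ≈ Q (3 ℕ.* ((n ℕ.+ k) ℕ.* (n ℕ.+ k))) * Po m1 3 6 (n ℕ.+ k) * R k * R (m ∸ k) * R (2 ℕ.* n ℕ.+ k)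
    term k k≤m = ≈trans (*-cong (*-cong ≈refl (≈≡ (P.cong R (P.trans (P.cong (_∸ (n ℕ.+ k)) (P.sym n+m≡M)) (NP.[m+n]∸[m+o]≡n∸o n m k)))))
                                  (*-cong (≈trans (Rd-in (n ℕ.+ k) n (NP.m≤m+n n k)) (≈≡ (P.cong R (NP.m+n∸m≡n n k)))) (≈≡ (P.cong R (arith₃ n k)))))
                         (regroup _ _ _ _ _)

  Rpair : ℕ → ℤ → S
  Rpair N j = Rz (+ N ℤ.- j) * Rz (+ N ℤ.+ j)

  Rpair-pos : ∀ N n → Rpair N (+ n) ≈ Rd N n * R (N ℕ.+ n)
  Rpair-pos N n = *-cong ≈refl (Rz-pos (N ℕ.+ n))

  Rpair-neg : ∀ N n → Rpair N -[1+ n ] ≈ Rd N (suc n) * R (N ℕ.+ suc n)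
  Rpair-neg N n = ≈trans (*-comm _ _) (*-cong ≈refl (Rz-pos (N ℕ.+ suc n)))

  -- the kernel for all integers j, using the symmetry j ↦ -j
  kernel : ∀ M j → ΣS (suc M) (λ N → Q3 N * Po3 N * R (M ∸ N) * Rpair N j) ≈ Po3 M * Q3 ∣ j ∣ * Rpair M j
  kernel M (+ n) = ≈trans (ΣS-cong' (suc M) (λ N → *-cong ≈refl (Rpair-pos N n))) (≈trans (kernel-nat M n) (*-cong ≈refl (≈sym (Rpair-pos M n))))
  kernel M -[1+ n ] = ≈trans (ΣS-cong' (suc M) (λ N → *-cong ≈refl (Rpair-neg N n))) (≈trans (kernel-nat M (suc n)) (*-cong ≈refl (≈sym (Rpair-neg M n))))

  Rpair-vanish : ∀ N n → N ≤ n → Rpair N -[1+ n ] ≈ 0# × Rpair N (+ suc n) ≈ 0#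
  Rpair-vanish N n N≤n = ≈trans (Rpair-neg N n) (≈trans (*-cong (Rd-out N (suc n) (s≤s N≤n)) ≈refl) (zeroˡ _))
                    , ≈trans (Rpair-pos N (suc n)) (≈trans (*-cong (Rd-out N (suc n) (s≤s N≤n)) ≈refl) (zeroˡ _))

  closedTerm : ℕ → ℕ → ℤ → S
  closedTerm ν N j = Q (E ν j) * Rpair N j

  closedForm : ℕ → ℕ → S
  closedForm ν M = Po3 M * SymS M (closedTerm ν M)

  closedTerm-extend : ∀ ν N M → N ≤ M → SymS M (closedTerm ν N) ≈ SymS N (closedTerm ν N)
  closedTerm-extend ν N M N≤M = ≈trans (≈≡ (P.cong (λ z → SymS z (closedTerm ν N)) (P.sym (NP.m∸n+n≡m N≤M))))
    (SymS-ext N (M ∸ N) (closedTerm ν N) (λ n N≤n → ≈trans (*-cong ≈refl (proj₁ (Rpair-vanish N n N≤n))) (zeroʳ _) , ≈trans (*-cong ≈refl (proj₂ (Rpair-vanish N n N≤n))) (zeroʳ _)))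

  -- The Bailey step: summing level ν against q^(3N²)/(q^6)_(M-N) gives level ν+1.
  -- Exchange the N- and j-sums and apply the kernel for each j.
  bailey-step : ∀ ν M → ΣS (suc M) (λ N → Q3 N * R (M ∸ N) * closedForm ν N) ≈ closedForm (suc ν) M
  bailey-step ν M = begin
    ΣS (suc M) (λ N → Q3 N * R (M ∸ N) * (Po3 N * SymS N (closedTerm ν N)))
      ≈⟨ ΣS-cong (suc M) (λ N N<sM → ≈trans (*-cong ≈refl (*-cong ≈refl (≈sym (closedTerm-extend ν N M (NP.<⇒≤pred N<sM))))) (each N)) ⟩
    ΣS (suc M) (λ N → SymS M (λ j → Q (E ν j) * (Q3 N * Po3 N * R (M ∸ N) * Rpair N j)))
      ≈⟨ ≈sym (SymS-ΣS M (suc M) (λ N j → Q (E ν j) * (Q3 N * Po3 N * R (M ∸ N) * Rpair N j))) ⟩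
    SymS M (λ j → ΣS (suc M) (λ N → Q (E ν j) * (Q3 N * Po3 N * R (M ∸ N) * Rpair N j)))
      ≈⟨ SymS-cong M (λ j → ≈trans (≈sym (ΣS-*ˡ (suc M) (λ N → Q3 N * Po3 N * R (M ∸ N) * Rpair N j) (Q (E ν j)))) (*-cong ≈refl (kernel M j))) ⟩
    SymS M (λ j → Q (E ν j) * (Po3 M * Q3 ∣ j ∣ * Rpair M j))
      ≈⟨ SymS-cong M (λ j → ≈trans (regroup₂ (Q (E ν j)) (Po3 M) (Q3 ∣ j ∣) (Rpair M j)) (*-cong ≈refl (*-cong (≈trans (Q-+ _ _) (Q-cong (E-step ν j))) ≈refl))) ⟩
    SymS M (λ j → Po3 M * closedTerm (suc ν) M j)
      ≈⟨ ≈sym (SymS-*ˡ M (closedTerm (suc ν) M) (Po3 M)) ⟩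
    closedForm (suc ν) M ∎
    where
    open SetoidR setoid
    pull-out : ∀ q r p x → q * r * (p * x) ≈ x * (q * r * p)
    pull-out = solve 4 (λ q r p x → q :* r :* (p :* x) := x :* (q :* r :* p)) ≈refl
    push-in : ∀ q r p e rr → (q * r * p) * (e * rr) ≈ e * (q * p * r * rr)
    push-in = solve 5 (λ q r p e rr → (q :* r :* p) :* (e :* rr) := e :* (q :* p :* r :* rr)) ≈refl
    regroup₂ : ∀ e p q rr → e * (p * q * rr) ≈ p * (e * q * rr)
    regroup₂ = solve 4 (λ e p q rr → e :* (p :* q :* rr) := p :* (e :* q :* rr)) ≈refl
    each : ∀ N → Q3 N * R (M ∸ N) * (Po3 N * SymS M (closedTerm ν N)) ≈ SymS M (λ j → Q (E ν j) * (Q3 N * Po3 N * R (M ∸ N) * Rpair N j))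
    each N = ≈trans (≈trans (pull-out (Q3 N) (R (M ∸ N)) (Po3 N) (SymS M (closedTerm ν N))) (*-comm _ _))
             (≈trans (SymS-*ˡ M (closedTerm ν N) (Q3 N * R (M ∸ N) * Po3 N)) (SymS-cong M (λ j → push-in (Q3 N) (R (M ∸ N)) (Po3 N) (Q (E ν j)) (Rpair N j))))

module BaseCase where

  open SeriesRing
  open SeriesSums
  open QFactorials
  open ChuVandermonde using (tri)
  open BaileyKernel using (tri2)
  open TripleProduct
  open SymmetricSums
  open Exponents
  open BaileyChain
  open import Data.Nat as ℕ using (ℕ; zero; suc; _∸_; _≤_; _<_)
  import Data.Nat.Properties as NP
  open import Data.Integer as ℤ using (+_; -[1+_])
  open import Relation.Binary.PropositionalEquality as P using (_≡_)
  import Relation.Binary.Reasoning.Setoid as SetoidR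
  open import Data.Nat.Tactic.RingSolver using (solve-∀)
  open import Data.Product using (_,_)

  Po-triple-split : ∀ c e M → Po c e 2 (3 ℕ.* M) ≈ Po c e 6 M * Po c (e ℕ.+ 2) 6 M * Po c (e ℕ.+ 4) 6 M
  Po-triple-split c e zero = ≈trans (Po-0 c e 2) (≈sym (≈trans (*-cong (*-cong (Po-0 c e 6) (Po-0 c _ 6)) (Po-0 c _ 6)) (≈trans (*-identityʳ _) (*-identityʳ _))))
  Po-triple-split c e (suc M) = begin
    Po c e 2 (3 ℕ.* suc M) ≈⟨ Po-cong c e e 2 _ _ P.refl (NP.*-suc 3 M) ⟩
    Po c e 2 (suc (suc (suc (3 ℕ.* M)))) ≈⟨ ≈trans (Po-suc c e 2 _) (*-cong ≈refl (≈trans (Po-suc c _ 2 _) (*-cong ≈refl (Po-suc c _ 2 _)))) ⟩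
    fac c e * (fac c (e ℕ.+ 2) * (fac c (e ℕ.+ 2 ℕ.+ 2) * Po c (e ℕ.+ 2 ℕ.+ 2 ℕ.+ 2) 2 (3 ℕ.* M)))
      ≈⟨ *-cong ≈refl (*-cong ≈refl (*-cong (fac-cong c (arith₁ e)) (≈trans (Po-cong c _ (e ℕ.+ 6) 2 _ _ (arith₂ e) P.refl) (Po-triple-split c (e ℕ.+ 6) M)))) ⟩
    fac c e * (fac c (e ℕ.+ 2) * (fac c (e ℕ.+ 4) * (Po c (e ℕ.+ 6) 6 M * Po c (e ℕ.+ 6 ℕ.+ 2) 6 M * Po c (e ℕ.+ 6 ℕ.+ 4) 6 M)))
      ≈⟨ regroup _ _ _ _ _ _ ⟩
    (fac c e * Po c (e ℕ.+ 6) 6 M) * (fac c (e ℕ.+ 2) * Po c (e ℕ.+ 6 ℕ.+ 2) 6 M) * (fac c (e ℕ.+ 4) * Po c (e ℕ.+ 6 ℕ.+ 4) 6 M)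
      ≈⟨ *-cong (*-cong (≈sym (Po-suc c e 6 M)) (≈trans (*-cong ≈refl (Po-cong c _ _ 6 M M (arith₃ e 2) P.refl)) (≈sym (Po-suc c (e ℕ.+ 2) 6 M))))
                (≈trans (*-cong ≈refl (Po-cong c _ _ 6 M M (arith₃ e 4) P.refl)) (≈sym (Po-suc c (e ℕ.+ 4) 6 M))) ⟩
    Po c e 6 (suc M) * Po c (e ℕ.+ 2) 6 (suc M) * Po c (e ℕ.+ 4) 6 (suc M) ∎
    where
    open SetoidR setoid
    arith₁ : ∀ e → e ℕ.+ 2 ℕ.+ 2 ≡ e ℕ.+ 4
    arith₁ = solve-∀
    arith₂ : ∀ e → e ℕ.+ 2 ℕ.+ 2 ℕ.+ 2 ≡ e ℕ.+ 6
    arith₂ = solve-∀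
    arith₃ : ∀ e k → e ℕ.+ 6 ℕ.+ k ≡ e ℕ.+ k ℕ.+ 6
    arith₃ = solve-∀
    regroup : ∀ a b c x y z → a * (b * (c * (x * y * z))) ≈ (a * x) * (b * y) * (c * z)
    regroup = solve 6 (λ a b c x y z → a :* (b :* (c :* (x :* y :* z))) := (a :* x) :* (b :* y) :* (c :* z)) ≈refl

  Rpair-negi : ∀ N i → Rpair N (ℤ.- (+ i)) ≈ Rd N i * R (N ℕ.+ i)
  Rpair-negi N zero = Rpair-pos N 0
  Rpair-negi N (suc i) = Rpair-neg N i

  E-negi : ∀ i → E 0 (ℤ.- (+ i)) ≡ 6 ℕ.* tri i ℕ.+ i
  E-negi zero = P.refl
  E-negi (suc i) = P.trans (E≡E' 0 -[1+ i ]) (arith i (tri i) (tri2 i))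
    where
    arith : ∀ i t → 2 ℕ.* t ℕ.+ i ≡ i ℕ.* i → suc i ℕ.* (3 ℕ.* (0 ℕ.+ 1) ℕ.* i ℕ.+ 3 ℕ.* 0 ℕ.+ 1) ≡ 6 ℕ.* (i ℕ.+ t) ℕ.+ suc i
    arith i t h = P.trans (arith₁ i) (P.trans (P.cong (λ z → 3 ℕ.* z ℕ.+ 4 ℕ.* i ℕ.+ 1) (P.sym h)) (arith₂ i t))
      where
      arith₁ : ∀ i → suc i ℕ.* (3 ℕ.* (0 ℕ.+ 1) ℕ.* i ℕ.+ 3 ℕ.* 0 ℕ.+ 1) ≡ 3 ℕ.* (i ℕ.* i) ℕ.+ 4 ℕ.* i ℕ.+ 1
      arith₁ = solve-∀
      arith₂ : ∀ i t → 3 ℕ.* (2 ℕ.* t ℕ.+ i) ℕ.+ 4 ℕ.* i ℕ.+ 1 ≡ 6 ℕ.* (i ℕ.+ t) ℕ.+ suc i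
      arith₂ = solve-∀

  E-posi : ∀ i → E 0 (+ suc i) ≡ 6 ℕ.* tri (suc i) ℕ.+ 5 ℕ.* suc i
  E-posi i = P.trans (E≡E' 0 (+ suc i)) (P.trans (arith₁ i) (P.trans (P.cong (λ z → 3 ℕ.* z ℕ.+ 8 ℕ.* i ℕ.+ 5) (P.sym (tri2 i))) (arith₂ i (tri i))))
    where
    arith₁ : ∀ i → 3 ℕ.* (0 ℕ.+ 1) ℕ.* suc i ℕ.* suc i ℕ.+ 2 ℕ.* suc i ≡ 3 ℕ.* (i ℕ.* i) ℕ.+ 8 ℕ.* i ℕ.+ 5
    arith₁ = solve-∀
    arith₂ : ∀ i t → 3 ℕ.* (2 ℕ.* t ℕ.+ i) ℕ.+ 8 ℕ.* i ℕ.+ 5 ≡ 6 ℕ.* (i ℕ.+ t) ℕ.+ 5 ℕ.* suc i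
    arith₂ = solve-∀

  tripleSum-symmetric : ∀ M → R (M ℕ.+ M) * tripleSum M M ≈ SymS M (closedTerm 0 M)
  tripleSum-symmetric M = begin
    R n * (negSum n M + posSum n M M) ≈⟨ distribˡ _ _ _ ⟩
    R n * negSum n M + R n * posSum n M M ≈⟨ +-cong (ΣS-*ˡ (suc M) (λ i → G n (M ∸ i) * negWeight i) (R n)) (ΣS-*ˡ M (λ i → G n (suc M ℕ.+ i) * posWeight i) (R n)) ⟩
    ΣS (suc M) (λ i → R n * (G n (M ∸ i) * negWeight i)) + ΣS M (λ i → R n * (G n (suc M ℕ.+ i) * posWeight i))
      ≈⟨ +-cong (ΣS-cong (suc M) (λ i i<sM → neg-term i (NP.<⇒≤pred i<sM))) (ΣS-cong M pos-term) ⟩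
    ΣS (suc M) (λ i → closedTerm 0 M (ℤ.- (+ i))) + ΣS M (λ i → closedTerm 0 M (+ suc i)) ≈⟨ ≈sym (SymS-split M (closedTerm 0 M)) ⟩
    SymS M (closedTerm 0 M) ∎
    where
    open SetoidR setoid
    n = M ℕ.+ M
    regroup : ∀ r g y → r * (g * y) ≈ y * (r * g)
    regroup = solve 3 (λ r g y → r :* (g :* y) := y :* (r :* g)) ≈refl
    neg-term : ∀ i → i ≤ M → R n * (G n (M ∸ i) * negWeight i) ≈ closedTerm 0 M (ℤ.- (+ i))
    neg-term i i≤M = ≈trans (regroup _ _ _) (*-cong (Q-cong (P.sym (E-negi i))) (≈trans (R2G n (M ∸ i) (NP.≤-trans (NP.m∸n≤m M i) (NP.m≤m+n M M)))
                 (≈trans (*-cong (≈sym (Rd-in M i i≤M)) (≈≡ (P.cong R ar))) (≈sym (Rpair-negi M i)))))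
      where
      ar : M ℕ.+ M ∸ (M ∸ i) ≡ M ℕ.+ i
      ar = P.trans (NP.+-∸-assoc M (NP.m∸n≤m M i)) (P.cong (M ℕ.+_) (NP.m∸[m∸n]≡n i≤M))
    pos-term : ∀ i → i < M → R n * (G n (suc M ℕ.+ i) * posWeight i) ≈ closedTerm 0 M (+ suc i)
    pos-term i i<M = ≈trans (regroup _ _ _) (*-cong (Q-cong (P.sym (E-posi i))) (≈trans (R2G n (suc M ℕ.+ i) le)
                 (≈trans (≈trans (*-comm _ _) (*-cong (≈trans (≈≡ (P.cong R ar)) (≈sym (Rd-in M (suc i) i<M))) (≈≡ (P.cong R (P.sym (NP.+-suc M i)))))) (≈sym (Rpair-pos M (suc i))))))
      where
      le : suc M ℕ.+ i ≤ M ℕ.+ M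
      le = P.subst (_≤ M ℕ.+ M) (NP.+-suc M i) (NP.+-monoʳ-≤ M i<M)
      ar : M ℕ.+ M ∸ (suc M ℕ.+ i) ≡ M ∸ suc i
      ar = P.trans (P.cong (M ℕ.+ M ∸_) (P.sym (NP.+-suc M i))) (NP.[m+n]∸[m+o]≡n∸o M M (suc i))

  baseSum : ℕ → S
  baseSum M = Po m1 1 2 (3 ℕ.* M) * R (2 ℕ.* M)

  base-case : ∀ M → baseSum M ≈ closedForm 0 M
  base-case M = begin
    Po m1 1 2 (3 ℕ.* M) * R (2 ℕ.* M) ≈⟨ *-cong (Po-triple-split m1 1 M) (≈≡ (P.cong R (arith M))) ⟩
    Po m1 1 6 M * Po m1 3 6 M * Po m1 5 6 M * R (M ℕ.+ M) ≈⟨ regroup _ _ _ _ ⟩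
    Po3 M * (R (M ℕ.+ M) * (Po m1 1 6 M * Po m1 5 6 M)) ≈⟨ *-cong ≈refl (*-cong ≈refl (≈sym (finite-triple-product M M))) ⟩
    Po3 M * (R (M ℕ.+ M) * tripleSum M M) ≈⟨ *-cong ≈refl (tripleSum-symmetric M) ⟩
    closedForm 0 M ∎
    where
    open SetoidR setoid
    arith : ∀ M → 2 ℕ.* M ≡ M ℕ.+ M
    arith = solve-∀
    regroup : ∀ a b c r → a * b * c * r ≈ b * (r * (a * c))
    regroup = solve 4 (λ a b c r → a :* b :* c :* r := b :* (r :* (a :* c))) ≈refl

module RightHandSide where

  open import Defs
  open SeriesRing
  open SeriesSums
  open QFactorials
  open SymmetricSums
  open BaileyChain
  open import Data.Nat as ℕ using (ℕ; zero; suc; _∸_; _≤_; z≤n)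
  import Data.Nat.Properties as NP
  open import Data.Integer as ℤ using (ℤ; +_; -[1+_]; ∣_∣)
  import Data.Integer.Properties as ZP
  open import Relation.Binary.PropositionalEquality as P using (_≡_)
  import Relation.Binary.Reasoning.Setoid as SetoidR
  open import Data.Nat.Tactic.RingSolver using (solve-∀)

  SymS-cong-in : ∀ M {h h'} → (∀ j → ∣ j ∣ ≤ M → h j ≈ h' j) → SymS M h ≈ SymS M h'
  SymS-cong-in zero e = e (+ 0) z≤n
  SymS-cong-in (suc M) e = +-cong (+-cong (e _ NP.≤-refl) (SymS-cong-in M (λ j j≤M → e j (NP.m≤n⇒m≤1+n j≤M)))) (e _ NP.≤-refl)

  rhsBinom : ℕ → ℤ → S
  rhsBinom M j = ⟨ gaussBinom 6 (+ (2 ℕ.* M)) (+ M ℤ.+ j) ⟩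

  binom-Rpair : ∀ M j → ∣ j ∣ ≤ M → R (2 ℕ.* M) * rhsBinom M j ≈ Rpair M j
  binom-Rpair M (+ n) n≤M = begin
    R (2 ℕ.* M) * rhsBinom M (+ n) ≈⟨ *-cong ≈refl (G-def (2 ℕ.* M) (M ℕ.+ n)) ⟩
    R (2 ℕ.* M) * G (2 ℕ.* M) (M ℕ.+ n) ≈⟨ R2G (2 ℕ.* M) (M ℕ.+ n) in-range ⟩
    R (M ℕ.+ n) * R (2 ℕ.* M ∸ (M ℕ.+ n)) ≈⟨ ≈trans (*-comm _ _) (*-cong (≈trans (≈≡ (P.cong R complement)) (≈sym (Rd-in M n n≤M))) ≈refl) ⟩
    Rd M n * R (M ℕ.+ n) ≈⟨ ≈sym (Rpair-pos M n) ⟩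
    Rpair M (+ n) ∎
    where
    open SetoidR setoid
    arith : ∀ M → 2 ℕ.* M ≡ M ℕ.+ M
    arith = solve-∀
    in-range : M ℕ.+ n ≤ 2 ℕ.* M
    in-range = P.subst (M ℕ.+ n ≤_) (P.sym (arith M)) (NP.+-monoʳ-≤ M n≤M)
    complement : 2 ℕ.* M ∸ (M ℕ.+ n) ≡ M ∸ n
    complement = P.trans (P.cong (_∸ (M ℕ.+ n)) (arith M)) (NP.[m+n]∸[m+o]≡n∸o M M n)
  binom-Rpair M -[1+ n ] sn≤M = begin
    R (2 ℕ.* M) * rhsBinom M -[1+ n ] ≈⟨ *-cong ≈refl (≈trans (≈≡ (P.cong (λ z → ⟨ gaussBinom 6 (+ (2 ℕ.* M)) z ⟩) index)) (G-def (2 ℕ.* M) (M ∸ suc n))) ⟩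
    R (2 ℕ.* M) * G (2 ℕ.* M) (M ∸ suc n) ≈⟨ R2G (2 ℕ.* M) (M ∸ suc n) in-range ⟩
    R (M ∸ suc n) * R (2 ℕ.* M ∸ (M ∸ suc n)) ≈⟨ *-cong (≈sym (Rd-in M (suc n) sn≤M)) (≈≡ (P.cong R complement)) ⟩
    Rd M (suc n) * R (M ℕ.+ suc n) ≈⟨ ≈sym (Rpair-neg M n) ⟩
    Rpair M -[1+ n ] ∎
    where
    open SetoidR setoid
    arith : ∀ M → 2 ℕ.* M ≡ M ℕ.+ M
    arith = solve-∀
    index : + M ℤ.+ -[1+ n ] ≡ + (M ∸ suc n)
    index = ZP.⊖-≥ sn≤M
    in-range : M ∸ suc n ≤ 2 ℕ.* M
    in-range = P.subst (M ∸ suc n ≤_) (P.sym (arith M)) (NP.≤-trans (NP.m∸n≤m M (suc n)) (NP.m≤m+n M M))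
    complement : 2 ℕ.* M ∸ (M ∸ suc n) ≡ M ℕ.+ suc n
    complement = P.trans (P.cong (_∸ (M ∸ suc n)) (arith M)) (P.trans (NP.+-∸-assoc M (NP.m∸n≤m M (suc n))) (P.cong (M ℕ.+_) (NP.m∸[m∸n]≡n sn≤M)))

  RHS-closedForm : ∀ ν M → ⟨ RHS ν M ⟩ ≈ closedForm ν M
  RHS-closedForm ν M = begin
    ⟨ RHS ν M ⟩ ≈⟨ ≈trans (≈sym (⊗-def (A *s B) C)) (*-cong (≈sym (⊗-def A B)) ≈refl) ⟩
    ⟨ A ⟩ * ⟨ B ⟩ * ⟨ C ⟩ ≈⟨ *-cong (*-cong (Po-def m1 3 6 M) (R-def (2 ℕ.* M))) (sym-link M f) ⟩
    Po3 M * R (2 ℕ.* M) * SymS M (λ j → ⟨ f j ⟩) ≈⟨ *-assoc _ _ _ ⟩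
    Po3 M * (R (2 ℕ.* M) * SymS M (λ j → ⟨ f j ⟩)) ≈⟨ *-cong ≈refl (SymS-*ˡ M (λ j → ⟨ f j ⟩) (R (2 ℕ.* M))) ⟩
    Po3 M * SymS M (λ j → R (2 ℕ.* M) * ⟨ f j ⟩) ≈⟨ *-cong ≈refl (SymS-cong-in M each) ⟩
    closedForm ν M ∎
    where
    open SetoidR setoid
    A = poch (ℤ.- (+ 1)) 3 6 M
    B = recipQfac 6 (2 ℕ.* M)
    f : ℤ → Series
    f j = qpow ∣ + (3 ℕ.* (ν ℕ.+ 1)) ℤ.* j ℤ.* j ℤ.+ + 2 ℤ.* j ∣ *s gaussBinom 6 (+ (2 ℕ.* M)) (+ M ℤ.+ j)
    C = sumS (map f (symRange M))
      where open import Data.List using (map)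
    regroup : ∀ r q g → r * (q * g) ≈ q * (r * g)
    regroup = solve 3 (λ r q g → r :* (q :* g) := q :* (r :* g)) ≈refl
    each : ∀ j → ∣ j ∣ ≤ M → R (2 ℕ.* M) * ⟨ f j ⟩ ≈ closedTerm ν M j
    each j j≤M = ≈trans (*-cong ≈refl (≈trans (≈sym (⊗-def _ _)) (*-cong (Q-def _) ≈refl))) (≈trans (regroup _ _ _) (*-cong ≈refl (binom-Rpair M j j≤M)))

module LeftHandSide where

  open import Defs
  open SeriesRing
  open SeriesSums
  open QFactorials
  open SymmetricSums
  open BaileyChain
  open BaseCase using (baseSum)
  open import Data.Nat as ℕ using (ℕ; zero; suc; _∸_; _≤_; _<_)
  import Data.Nat.Properties as NP
  open import Data.Integer as ℤ using (+_; -[1+_])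
  open import Data.List using ([]; _∷_; map; upTo)
  open import Data.Vec using (Vec; []; _∷_)
  open import Relation.Binary.PropositionalEquality as P using (_≡_)
  import Relation.Binary.Reasoning.Setoid as SetoidR
  open import Relation.Nullary using (yes; no)

  iteratedSum : ℕ → ℕ → S
  iteratedSum zero M = baseSum M
  iteratedSum (suc ν) M = ΣS (suc M) (λ N → Q3 N * R (M ∸ N) * iteratedSum ν N)

  tailWeight : ∀ {k} → Vec ℕ (suc k) → S
  tailWeight v = Q (3 ℕ.* sqSuffix v) * Po m1 1 2 (3 ℕ.* lastV v) * ⟨ denoms v ⟩

  unwrap-product₄ : ∀ a b c d → ⟨ a *s b *s c *s d ⟩ ≈ ⟨ a ⟩ * ⟨ b ⟩ * ⟨ c ⟩ * ⟨ d ⟩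
  unwrap-product₄ a b c d = ≈trans (≈sym (⊗-def (a *s b *s c) d)) (*-cong (≈trans (≈sym (⊗-def (a *s b) c)) (*-cong (≈sym (⊗-def a b)) ≈refl)) ≈refl)

  term-fact : ∀ μ N (v : Vec ℕ (suc μ)) → ⟨ lhsTerm μ N v ⟩ ≈ Rd N (vsum v) * tailWeight v
  term-fact μ N v = ≈trans (unwrap-product₄ _ _ _ _) (≈trans (*-cong (*-cong (*-cong (Q-def _) (Po-def _ _ _ _)) (Rz-def _)) ≈refl) (regroup _ _ _ _))
    where
    regroup : ∀ a b c d → a * b * c * d ≈ c * (a * b * d)
    regroup = solve 4 (λ a b c d → a :* b :* c :* d := c :* (a :* b :* d)) ≈refl

  headWeight : ℕ → ℕ → ℕ → S
  headWeight M n1 s = Q (3 ℕ.* ((n1 ℕ.+ s) ℕ.* (n1 ℕ.+ s))) * R n1 * Rd M (n1 ℕ.+ s)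

  term-step : ∀ μ M n1 (v : Vec ℕ (suc μ)) → ⟨ lhsTerm (suc μ) M (n1 ∷ v) ⟩ ≈ headWeight M n1 (vsum v) * tailWeight v
  term-step μ M n1 (y ∷ ys) = begin
    ⟨ lhsTerm (suc μ) M (n1 ∷ y ∷ ys) ⟩ ≈⟨ unwrap-product₄ _ _ _ _ ⟩
    ⟨ qpow (3 ℕ.* sqSuffix (n1 ∷ y ∷ ys)) ⟩ * ⟨ poch (ℤ.- (+ 1)) 1 2 (3 ℕ.* lastV (y ∷ ys)) ⟩ * ⟨ recipQfacℤ 6 (+ M ℤ.- + (n1 ℕ.+ s)) ⟩ * ⟨ recipQfac 6 n1 *s denoms (y ∷ ys) ⟩
      ≈⟨ *-cong (*-cong (*-cong (≈trans (Q-def _) (≈trans (Q-cong (NP.*-distribˡ-+ 3 ((n1 ℕ.+ s) ℕ.* (n1 ℕ.+ s)) (sqSuffix (y ∷ ys)))) (≈sym (Q-+ _ _)))) (Po-def _ _ _ _)) (Rz-def _)) (≈trans (≈sym (⊗-def _ _)) (*-cong (R-def n1) ≈refl)) ⟩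
    Q (3 ℕ.* ((n1 ℕ.+ s) ℕ.* (n1 ℕ.+ s))) * Q (3 ℕ.* sqSuffix (y ∷ ys)) * Po m1 1 2 (3 ℕ.* lastV (y ∷ ys)) * Rd M (n1 ℕ.+ s) * (R n1 * ⟨ denoms (y ∷ ys) ⟩)
      ≈⟨ regroup _ _ _ _ _ _ ⟩
    headWeight M n1 s * tailWeight (y ∷ ys) ∎
    where
    open SetoidR setoid
    s = vsum (y ∷ ys)
    regroup : ∀ q1 q2 p r r1 d → q1 * q2 * p * r * (r1 * d) ≈ q1 * r1 * r * (q2 * p * d)
    regroup = solve 6 (λ q1 q2 p r r1 d → q1 :* q2 :* p :* r :* (r1 :* d) := q1 :* r1 :* r :* (q2 :* p :* d)) ≈refl

  head-sum : ∀ B M s → M ≤ B → ΣS (suc B) (λ n1 → headWeight M n1 s) ≈ ΣS (suc M) (λ N → Q3 N * R (M ∸ N) * Rd N s)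
  head-sum B M s M≤B with s ℕ.≤? M
  ... | no s≰M = ≈trans (ΣS-zero (suc B) _ (λ n1 _ → vanishing n1)) (≈sym (ΣS-zero (suc M) _ (λ N N<sM → ≈trans (*-cong ≈refl (Rd-out N s (NP.<-≤-trans N<sM (NP.≰⇒> s≰M)))) (zeroʳ _))))
    where
    vanishing : ∀ n1 → headWeight M n1 s ≈ 0#
    vanishing n1 = ≈trans (*-cong ≈refl (Rd-out M (n1 ℕ.+ s) (NP.<-≤-trans (NP.≰⇒> s≰M) (NP.m≤n+m s n1)))) (zeroʳ _)
  ... | yes s≤M = begin
    ΣS (suc B) (λ n1 → headWeight M n1 s)
      ≈⟨ ΣS-trunc B m (λ n1 → headWeight M n1 s) (NP.≤-trans (NP.m∸n≤m M s) M≤B) (λ k m<k → ≈trans (*-cong ≈refl (Rd-out M (k ℕ.+ s) (beyond-M k m<k))) (zeroʳ _)) ⟩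
    ΣS (suc m) (λ n1 → headWeight M n1 s)
      ≈⟨ ΣS-cong (suc m) (λ k k<sm → head-term k (NP.<⇒≤pred k<sm)) ⟩
    ΣS (suc m) (λ k → Q3 (s ℕ.+ k) * R (m ∸ k) * R k)
      ≈⟨ ≈sym (ΣS-cong (suc m) (λ k k<sm → range-term k)) ⟩
    ΣS (suc m) (λ k → f (s ℕ.+ k))
      ≈⟨ ≈sym (≈trans (+-cong (ΣS-zero s f (λ N N<s → ≈trans (*-cong ≈refl (Rd-out N s N<s)) (zeroʳ _))) ≈refl) (+-identityˡ _)) ⟩
    ΣS s f + ΣS (suc m) (λ k → f (s ℕ.+ k))
      ≈⟨ ≈sym (ΣS-split s (suc m) f) ⟩
    ΣS (s ℕ.+ suc m) f
      ≈⟨ ΣS-count f (P.trans (NP.+-suc s m) (P.cong suc (NP.m+[n∸m]≡n s≤M))) ⟩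
    ΣS (suc M) f ∎
    where
    open SetoidR setoid
    m = M ∸ s
    f : ℕ → S
    f N = Q3 N * R (M ∸ N) * Rd N s
    beyond-M : ∀ k → m < k → M < k ℕ.+ s
    beyond-M k m<k = P.subst (_< k ℕ.+ s) (NP.m∸n+n≡m s≤M) (NP.+-monoˡ-< s m<k)
    head-term : ∀ k → k ≤ m → headWeight M k s ≈ Q3 (s ℕ.+ k) * R (m ∸ k) * R k
    head-term k k≤m = ≈trans (*-cong (*-cong (Q-cong (P.cong (λ z → 3 ℕ.* (z ℕ.* z)) (NP.+-comm k s))) ≈refl)
                             (≈trans (Rd-in M (k ℕ.+ s) (P.subst (k ℕ.+ s ≤_) (NP.m∸n+n≡m s≤M) (NP.+-monoˡ-≤ s k≤m))) (≈≡ (P.cong R (P.trans (P.cong (M ∸_) (NP.+-comm k s)) (P.sym (NP.∸-+-assoc M s k)))))))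
                      (regroup _ _ _)
      where
      regroup : ∀ a b c → a * b * c ≈ a * c * b
      regroup = solve 3 (λ a b c → a :* b :* c := a :* c :* b) ≈refl
    range-term : ∀ k → f (s ℕ.+ k) ≈ Q3 (s ℕ.+ k) * R (m ∸ k) * R k
    range-term k = *-cong (*-cong ≈refl (≈≡ (P.cong R (P.sym (NP.∸-+-assoc M s k))))) (≈trans (Rd-in (s ℕ.+ k) s (NP.m≤m+n s k)) (≈≡ (P.cong R (NP.m+n∸m≡n s k))))

  boxSum : ℕ → ℕ → ℕ → S
  boxSum μ B M = listSum (boxVecs (suc μ) B) (λ v → ⟨ lhsTerm μ M v ⟩)

  box-split : ∀ k B (g : Vec ℕ (suc k) → S) → listSum (boxVecs (suc k) B) g ≈ ΣS (suc B) (λ x → listSum (boxVecs k B) (λ v → g (x ∷ v)))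
  box-split k B g = ≈trans (listSum-concatMap (upTo (suc B)) (λ x → map (x ∷_) (boxVecs k B)) g)
                           (≈trans (listSum-cong (upTo (suc B)) (λ x → listSum-map (boxVecs k B) (x ∷_) g)) (listSum-upTo (suc B) _))

  boxSum-iterated : ∀ μ B M → M ≤ B → boxSum μ B M ≈ iteratedSum (suc μ) M
  boxSum-iterated zero B M M≤B = begin
    boxSum 0 B M ≈⟨ box-split 0 B (λ v → ⟨ lhsTerm 0 M v ⟩) ⟩
    ΣS (suc B) (λ x → ⟨ lhsTerm 0 M (x ∷ []) ⟩ + 0#) ≈⟨ ΣS-cong' (suc B) (λ x → ≈trans (+-identityʳ _) (term-fact 0 M (x ∷ []))) ⟩
    ΣS (suc B) (λ x → Rd M (x ℕ.+ 0) * tailWeight (x ∷ [])) ≈⟨ ΣS-trunc B M _ M≤B (λ k M<k → ≈trans (*-cong (Rd-out M (k ℕ.+ 0) (P.subst (M <_) (P.sym (NP.+-identityʳ k)) M<k)) ≈refl) (zeroˡ _)) ⟩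
    ΣS (suc M) (λ x → Rd M (x ℕ.+ 0) * tailWeight (x ∷ [])) ≈⟨ ΣS-cong (suc M) (λ x x<sM → single-term x (NP.<⇒≤pred x<sM)) ⟩
    iteratedSum 1 M ∎
    where
    open SetoidR setoid
    regroup : ∀ r q p d → r * (q * p * d) ≈ q * r * (p * d)
    regroup = solve 4 (λ r q p d → r :* (q :* p :* d) := q :* r :* (p :* d)) ≈refl
    single-term : ∀ x → x ≤ M → Rd M (x ℕ.+ 0) * tailWeight (x ∷ []) ≈ Q3 x * R (M ∸ x) * baseSum x
    single-term x x≤M = ≈trans (*-cong (≈trans (≈≡ (P.cong (Rd M) (NP.+-identityʳ x))) (Rd-in M x x≤M))
                             (*-cong (*-cong (Q-cong (P.cong (λ z → 3 ℕ.* z) (P.trans (NP.+-identityʳ _) (P.cong (λ z → z ℕ.* z) (NP.+-identityʳ x))))) ≈refl) (R-def (2 ℕ.* x))))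
                     (regroup _ _ _ _)
  boxSum-iterated (suc μ) B M M≤B = begin
    boxSum (suc μ) B M ≈⟨ box-split (suc μ) B (λ w → ⟨ lhsTerm (suc μ) M w ⟩) ⟩
    ΣS (suc B) (λ n1 → listSum box (λ v → ⟨ lhsTerm (suc μ) M (n1 ∷ v) ⟩))
      ≈⟨ ΣS-cong' (suc B) (λ n1 → listSum-cong box (λ v → term-step μ M n1 v)) ⟩
    ΣS (suc B) (λ n1 → listSum box (λ v → headWeight M n1 (vsum v) * tailWeight v))
      ≈⟨ listSum-ΣS box (suc B) (λ n1 v → headWeight M n1 (vsum v) * tailWeight v) ⟩
    listSum box (λ v → ΣS (suc B) (λ n1 → headWeight M n1 (vsum v) * tailWeight v))
      ≈⟨ listSum-cong box (λ v → ≈trans (≈sym (ΣS-*ʳ (suc B) (λ n1 → headWeight M n1 (vsum v)) (tailWeight v))) (≈trans (*-cong (head-sum B M (vsum v) M≤B) ≈refl) (ΣS-*ʳ (suc M) _ (tailWeight v)))) ⟩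
    listSum box (λ v → ΣS (suc M) (λ N → Q3 N * R (M ∸ N) * Rd N (vsum v) * tailWeight v))
      ≈⟨ ≈sym (listSum-ΣS box (suc M) (λ N v → Q3 N * R (M ∸ N) * Rd N (vsum v) * tailWeight v)) ⟩
    ΣS (suc M) (λ N → listSum box (λ v → Q3 N * R (M ∸ N) * Rd N (vsum v) * tailWeight v))
      ≈⟨ ΣS-cong' (suc M) (λ N → ≈trans (listSum-cong box (λ v → ≈trans (*-assoc _ _ _) (*-cong ≈refl (≈sym (term-fact μ N v))))) (≈sym (listSum-*ˡ box (λ v → ⟨ lhsTerm μ N v ⟩) (Q3 N * R (M ∸ N))))) ⟩
    ΣS (suc M) (λ N → Q3 N * R (M ∸ N) * boxSum μ B N)
      ≈⟨ ΣS-cong (suc M) (λ N N<sM → *-cong ≈refl (boxSum-iterated μ B N (NP.≤-trans (NP.<⇒≤pred N<sM) M≤B))) ⟩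
    iteratedSum (suc (suc μ)) M ∎
    where
    open SetoidR setoid
    box = boxVecs (suc μ) B

  LHS-iterated : ∀ μ M → ⟨ LHS (suc μ) M ⟩ ≈ iteratedSum (suc μ) M
  LHS-iterated μ M = ≈trans (listSum-link (boxVecs (suc μ) M) (lhsTerm μ M)) (boxSum-iterated μ M M NP.≤-refl)

open SeriesRing
open SeriesSums
open BaileyChain
open BaseCase
open RightHandSide
open LeftHandSide

iteratedSum≈closedForm : ∀ ν M → iteratedSum ν M ≈ closedForm ν M
iteratedSum≈closedForm zero M = base-case M
iteratedSum≈closedForm (suc ν) M =
  ≈trans (ΣS-cong' (suc M) (λ N → *-cong ≈refl (iteratedSum≈closedForm ν N))) (bailey-step ν M)

theorem5p2 : (μ M : ℕ) → LHS (suc μ) M ≈s RHS (suc μ) M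
theorem5p2 μ M = pt (begin
  ⟨ LHS (suc μ) M ⟩       ≈⟨ LHS-iterated μ M ⟩
  iteratedSum (suc μ) M   ≈⟨ iteratedSum≈closedForm (suc μ) M ⟩
  closedForm (suc μ) M    ≈⟨ ≈sym (RHS-closedForm (suc μ) M) ⟩
  ⟨ RHS (suc μ) M ⟩       ∎)
  where open SetoidR setoid
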